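{- Let $\mathcal A'=(A_1',\dots,A_q')$ be any tuple of nonempty finite sets of integers, and fix $t,r\in\mathbb N$. Then there exists a threshold vector $\mathbf h_{r,t}\in\mathbb N_0^q$ such that for every $\mathbf h\succeq\mathbf h_{r,t}$ there exists $X_{\mathbf h}\subseteq\mathbb Z$ with $|X_{\mathbf h}|\le r+2$ and \[ ((r\mathbf h)\cdot\mathcal A')^{(t)}\subseteq X_{\mathbf h}+(\mathbf h\cdot\mathcal A')^{(t)}. \]
   Context: $\mathbb N=\{1,2,\dots\}$, $\mathbb N_0=\{0,1,2,\dots\}$. For $\mathbf h=(h_1,\dots,h_q)\in\mathbb N_0^q$, $r\mathbf h=(rh_1,\dots,rh_q)$ and $\mathbf h\preceq\mathbf h'$ means $h_i\le h_i'$ for all $i$. The chromatic representation function $r_{\mathcal A,\mathbf h}(n)$ counts tuples $(a_{1,1},\dots,a_{1,h_1};\dots;a_{q,1},\dots,a_{q,h_q})$ with $a_{i,j}\in A_i$, $a_{i,1}\le\cdots\le a_{i,h_i}$ for each $i$, and $\sum_{i,j}a_{i,j}=n$. For $t\in\mathbb N$, $(\mathbf h\cdot\mathcal A)^{(t)}=\{n\in\mathbb Z:r_{\mathcal A,\mathbf h}(n)\ge t\}$. For $X,Y\subseteq\mathbb Z$, $X+Y=\{x+y:x\in X,y\in Y\}$. -}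

module Defs where

open import Data.Bool using (Bool; true; false; _∧_)
open import Data.Nat as ℕ using (ℕ; zero; suc)
open import Data.Integer as ℤ using (ℤ; _≤ᵇ_)
open import Data.List as List using (List; []; _∷_; concatMap; map; filter; filterᵇ; length)
open import Data.Vec as Vec using (Vec; []; _∷_)
open import Relation.Nullary using (Dec)
import Data.Integer.Properties as ℤP

allTuples : List ℤ → (k : ℕ) → List (List ℤ)
allTuples A zero    = [] ∷ []
allTuples A (suc k) = concatMap (λ a → map (a ∷_) (allTuples A k)) A

nondecreasing : List ℤ → Bool
nondecreasing []           = true
nondecreasing (x ∷ [])     = true
nondecreasing (x ∷ y ∷ xs) = (x ≤ᵇ y) ∧ nondecreasing (y ∷ xs)

ndTuples : List ℤ → ℕ → List (List ℤ)
ndTuples A k = filterᵇ nondecreasing (allTuples A k)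

chromTuples : ∀ {q} → Vec (List ℤ) q → Vec ℕ q → List (List (List ℤ))
chromTuples []       []       = [] ∷ []
chromTuples (A ∷ As) (h ∷ hs) =
  concatMap (λ v → map (v ∷_) (chromTuples As hs)) (ndTuples A h)

sumℤ : List ℤ → ℤ
sumℤ = List.foldr ℤ._+_ (ℤ.+ 0)

totalSum : List (List ℤ) → ℤ
totalSum T = sumℤ (map sumℤ T)

rep : ∀ {q} → Vec (List ℤ) q → Vec ℕ q → ℤ → ℕ
rep A h n = length (filter (λ T → totalSum T ℤP.≟ n) (chromTuples A h))

InRestricted : ∀ {q} → ℕ → Vec (List ℤ) q → Vec ℕ q → ℤ → Set
InRestricted t A h n = t ℕ.≤ rep A h n

scale : ∀ {q} → ℕ → Vec ℕ q → Vec ℕ q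
scale r = Vec.map (r ℕ.*_)

{-# OPTIONS --safe #-}
-- Measure a representation from the minima mᵢ = min Aᵢ (its excess) and from the maxima
-- Mᵢ = max Aᵢ (its deficit).  Both are multiples of the gcd D of all gaps a − mᵢ, and for
-- profile h they add up to D·ε(h), where ε(h) = Σ hᵢ (Mᵢ − mᵢ)/D.  Let h be large.  If a
-- value of (rh·A)^(t) has a representation of small excess, then all its representations
-- start with (r − 1)hᵢ copies of mᵢ in colour i, and deleting them maps them injectively to
-- representations of profile h; symmetrically for a small deficit.  This gives two
-- translates.  Every other value is a multiple of D inside a middle window of length about
-- r·D·ε(h), which is covered by r translates of the middle window for profile h once that
-- window is saturated, i.e. each of its multiples of D has t representations.  Saturation
-- holds at a constant profile h₀ by explicit seeds (a Bézout combination of the gaps walks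
-- through consecutive multiples of D, and t witness multisets with equal gap sums give t
-- distinct representations), and it spreads from h₀ to every h ≥ h₀ one unit step at a
-- time: a value either keeps its representations after prepending mᵢ, or inherits them
-- from the value D·δᵢ lower after appending Mᵢ.  Such witnesses exist unless at most one
-- non-minimal entry occurs at all; but then a representation is determined by its sum, so
-- (h·A)^(t) is empty for t ≥ 2.
module Submission where

open import Defs
open import Data.Nat using (ℕ; _≤_; _+_)
open import Data.Integer as ℤ using (ℤ)
open import Data.List using (List; length)
open import Data.List.Membership.Propositional using (_∈_)
open import Data.List.Relation.Unary.All using (All)
open import Data.List.Relation.Unary.Unique.Propositional using (Unique)
open import Data.Vec using (Vec)
import Data.Vec.Relation.Unary.All as VAll
open import Data.Vec.Relation.Binary.Pointwise.Inductive using (Pointwise)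
open import Data.Product using (Σ; _×_; ∃; ∃-syntax)
open import Relation.Binary.PropositionalEquality using (_≡_; _≢_)

import Data.Integer.Properties as ℤP
import Data.Nat.Properties as ℕP
open import Algebra.Properties.AbelianGroup ℤP.+-0-abelianGroup
  using (∙-cancelˡ; ∙-cancelʳ; //-rightDividesˡ; //-rightDividesʳ)
open import Algebra.Properties.CommutativeSemigroup ℤP.+-commutativeSemigroup
  using (interchange; x∙yz≈y∙xz; x∙yz≈yx∙z; xy∙z≈xz∙y; xy∙z≈y∙xz)
import Algebra.Properties.CommutativeSemigroup ℕP.+-commutativeSemigroup as ℕ-+
import Algebra.Properties.CommutativeSemigroup ℕP.*-commutativeSemigroup as ℕ-*
open import Data.Bool using (T; T?)
open import Data.Bool.Properties using (T-∧)
open import Data.Empty using (⊥; ⊥-elim)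
open import Data.Fin as Fin using (Fin; zero; suc)
open import Data.Integer using (+_; ∣_∣)
import Data.Integer.Tactic.RingSolver as ℤ-Solver
open import Data.List
  using ([]; _∷_; replicate; drop; take; _++_; map; filter; concatMap; cartesianProductWith; allFin; upTo)
open import Data.List.Extrema ℤP.≤-totalOrder using (min; max; argmin-sel; argmax-sel; min≤⊤; min≤xs; ⊥≤max; xs≤max)
open import Data.List.Membership.Propositional using (find; lose)
open import Data.List.Membership.Propositional.Properties
  using ( ∈-cartesianProductWith⁺; ∈-cartesianProductWith⁻; ∈-filter⁺; ∈-filter⁻; ∈-∃++; ∈-++⁺ˡ; ∈-++⁺ʳ; ∈-++⁻
        ; ∈-concatMap⁺; ∈-concatMap⁻; ∈-map⁺; ∈-map⁻; ∈-allFin; ∈-upTo⁺; ∈-upTo⁻)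
open import Data.List.Properties
  using ( ∷-injective; length-++; length-++-sucʳ; length-map; length-replicate; length-drop; length-take; length-upTo
        ; take++drop≡id; map-∘; map-id-local; map-++; filter-++; filter-all; filter-none; filter-accept; filter-reject)
import Data.List.Relation.Binary.Permutation.Propositional as ↭
open import Data.List.Relation.Binary.Permutation.Propositional using (_↭_; ↭-sym)
open import Data.List.Relation.Binary.Permutation.Propositional.Properties using (↭-length; All-resp-↭; filter-↭)
open import Data.List.Relation.Unary.All as All using ([]; _∷_)
import Data.List.Relation.Unary.All.Properties as AllP
open import Data.List.Relation.Unary.AllPairs using (AllPairs; []; _∷_)
import Data.List.Relation.Unary.AllPairs.Properties as AllPairsP
open import Data.List.Relation.Unary.Any using (here; there; any?)
open import Data.List.Relation.Unary.Linked using (Linked; []; [-]; _∷_)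
open import Data.List.Relation.Unary.Linked.Properties using (Linked⇒AllPairs; AllPairs⇒Linked)
import Data.List.Relation.Unary.Unique.Propositional.Properties as UniqueP
open import Data.List.Sort.InsertionSort.Base ℤP.≤-decTotalOrder using (insert)
open import Data.List.Sort.InsertionSort.Properties ℤP.≤-decTotalOrder using (insert-↭; insert-↗)
open import Data.Nat as ℕ using (zero; suc; _<_; _∸_; z≤n; s≤s; z<s; _≤?_; NonZero)
open import Data.Nat.DivMod using (_/_; _%_; m≡m%n+[m/n]*n; m%n<n; m<n*o⇒m/o<n)
open import Data.Nat.Divisibility using (_∣_; divides; quotient; ∣-trans; ∣m∣n⇒∣m+n)
open import Data.Nat.GCD using (module Bézout; module GCD)
open import Data.Nat.ListAction using (sum)
open import Data.Nat.ListAction.Properties using (sum-++)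
import Data.Nat.Tactic.RingSolver as ℕ-Solver
open import Data.Product using (_,_; proj₁; proj₂)
open import Data.Product.Properties using (≡-dec)
open import Data.Sum using (_⊎_; inj₁; inj₂; [_,_]′)
open import Data.Vec as Vec using ([]; _∷_; lookup; _[_]%=_)
open import Data.Vec.Properties using (zipWith-identityʳ; lookup∘tabulate)
open import Data.Vec.Relation.Binary.Pointwise.Inductive as Pointwise using ([]; _∷_)
open import Function using (id; _∘_; _∘′_; Equivalence)
open import Relation.Binary.Definitions using (DecidableEquality)
open import Relation.Binary.PropositionalEquality using (refl; sym; trans; cong; cong₂; subst; module ≡-Reasoning)
open import Relation.Nullary using (Dec; yes; no; ¬?; _×-dec_)

Sorted : List ℤ → Set
Sorted = AllPairs ℤ._≤_

record Row (A : List ℤ) (k : ℕ) (v : List ℤ) : Set where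
  constructor row
  field
    length≡ : length v ≡ k
    entries : All (_∈ A) v
    sorted  : Sorted v

data Chromatic : ∀ {q} → Vec (List ℤ) q → Vec ℕ q → List (List ℤ) → Set where
  []  : Chromatic [] [] []
  _∷_ : ∀ {q A k v} {As : Vec (List ℤ) q} {h T} →
        Row A k v → Chromatic As h T → Chromatic (A ∷ As) (k ∷ h) (v ∷ T)

nondecreasing⇒sorted : ∀ v → T (nondecreasing v) → Sorted v
nondecreasing⇒sorted v = Linked⇒AllPairs ℤP.≤-trans ∘ linked v
  where
  linked : ∀ v → T (nondecreasing v) → Linked ℤ._≤_ v
  linked []          _  = []
  linked (x ∷ [])    _  = [-]
  linked (x ∷ y ∷ v) nd = ℤP.≤ᵇ⇒≤ (proj₁ (Equivalence.to T-∧ nd)) ∷ linked (y ∷ v) (proj₂ (Equivalence.to T-∧ nd))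

sorted⇒nondecreasing : ∀ {v} → Sorted v → T (nondecreasing v)
sorted⇒nondecreasing = unlinked ∘ AllPairs⇒Linked
  where
  unlinked : ∀ {v} → Linked ℤ._≤_ v → T (nondecreasing v)
  unlinked []        = _
  unlinked [-]       = _
  unlinked (x≤y ∷ l) = Equivalence.from T-∧ (ℤP.≤⇒≤ᵇ x≤y , unlinked l)

concatMap-∷≡cartesianProduct : ∀ {X : Set} (xs : List X) (yss : List (List X)) →
  concatMap (λ x → map (x ∷_) yss) xs ≡ cartesianProductWith _∷_ xs yss
concatMap-∷≡cartesianProduct []       yss = refl
concatMap-∷≡cartesianProduct (x ∷ xs) yss = cong (map (x ∷_) yss ++_) (concatMap-∷≡cartesianProduct xs yss)

∈-allTuples⁺ : ∀ {A} v → All (_∈ A) v → v ∈ allTuples A (length v)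
∈-allTuples⁺     []      []         = here refl
∈-allTuples⁺ {A} (a ∷ v) (a∈ ∷ v⊆) =
  subst (a ∷ v ∈_) (sym (concatMap-∷≡cartesianProduct A _))
    (∈-cartesianProductWith⁺ _∷_ a∈ (∈-allTuples⁺ v v⊆))

∈-allTuples⁻ : ∀ {A} k {v} → v ∈ allTuples A k → length v ≡ k × All (_∈ A) v
∈-allTuples⁻     zero    (here refl) = refl , []
∈-allTuples⁻ {A} (suc k) v∈
  with a , u , a∈ , u∈ , refl ← ∈-cartesianProductWith⁻ _∷_ A _ (subst (_ ∈_) (concatMap-∷≡cartesianProduct A _) v∈)
  with refl , u⊆ ← ∈-allTuples⁻ k u∈
  = refl , a∈ ∷ u⊆

allTuples-unique : ∀ {A} k → Unique A → Unique (allTuples A k)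
allTuples-unique     zero    _  = [] ∷ []
allTuples-unique {A} (suc k) uA = subst Unique (sym (concatMap-∷≡cartesianProduct A _))
  (UniqueP.cartesianProductWith⁺ _∷_ ∷-injective uA (allTuples-unique k uA))

∈-ndTuples⁺ : ∀ {A k v} → Row A k v → v ∈ ndTuples A k
∈-ndTuples⁺ {v = v} (row refl v⊆ v↗) = ∈-filter⁺ (T? ∘ nondecreasing) (∈-allTuples⁺ v v⊆) (sorted⇒nondecreasing v↗)

∈-ndTuples⁻ : ∀ {A} k {v} → v ∈ ndTuples A k → Row A k v
∈-ndTuples⁻ {A} k {v} v∈
  with v∈′ , nd ← ∈-filter⁻ (T? ∘ nondecreasing) {xs = allTuples A k} v∈
  with len , v⊆ ← ∈-allTuples⁻ k v∈′
  = row len v⊆ (nondecreasing⇒sorted v nd)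

∈-chromTuples⁺ : ∀ {q} {A : Vec (List ℤ) q} {h T} → Chromatic A h T → T ∈ chromTuples A h
∈-chromTuples⁺ []                        = here refl
∈-chromTuples⁺ {A = A ∷ _} {k ∷ _} (r ∷ c) = subst (_ ∈_) (sym (concatMap-∷≡cartesianProduct (ndTuples A k) _))
  (∈-cartesianProductWith⁺ _∷_ (∈-ndTuples⁺ r) (∈-chromTuples⁺ c))

∈-chromTuples⁻ : ∀ {q} (A : Vec (List ℤ) q) h {T} → T ∈ chromTuples A h → Chromatic A h T
∈-chromTuples⁻ []       []      (here refl) = []
∈-chromTuples⁻ (A ∷ As) (k ∷ h) T∈
  with v , T′ , v∈ , T′∈ , refl ← ∈-cartesianProductWith⁻ _∷_ (ndTuples A k) _
                                     (subst (_ ∈_) (concatMap-∷≡cartesianProduct (ndTuples A k) _) T∈)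
  = ∈-ndTuples⁻ k v∈ ∷ ∈-chromTuples⁻ As h T′∈

chromTuples-unique : ∀ {q} {A : Vec (List ℤ) q} h → VAll.All Unique A → Unique (chromTuples A h)
chromTuples-unique []      VAll.[]          = [] ∷ []
chromTuples-unique {A = A ∷ _} (k ∷ h) (uA VAll.∷ uAs) = subst Unique (sym (concatMap-∷≡cartesianProduct (ndTuples A k) _))
  (UniqueP.cartesianProductWith⁺ _∷_ ∷-injective (UniqueP.filter⁺ _ (allTuples-unique k uA)) (chromTuples-unique h uAs))

unique⊆⇒length≤ : ∀ {X : Set} {xs ys : List X} → Unique xs → All (_∈ ys) xs → length xs ≤ length ys
unique⊆⇒length≤ {xs = []}               _              _              = z≤n
unique⊆⇒length≤ {xs = x ∷ xs} {ys} (x∉xs ∷ uxs) (x∈ys ∷ xs⊆ys) with ys₁ , ys₂ , refl ← ∈-∃++ x∈ys =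
  subst (suc (length xs) ≤_) (sym (length-++-sucʳ ys₁ x ys₂))
    (s≤s (unique⊆⇒length≤ uxs (All.zipWith avoid (x∉xs , xs⊆ys))))
  where
  avoid : ∀ {z} → x ≢ z × z ∈ ys₁ ++ x ∷ ys₂ → z ∈ ys₁ ++ ys₂
  avoid (x≢z , z∈) with ∈-++⁻ ys₁ z∈
  ... | inj₁ z∈ys₁          = ∈-++⁺ˡ z∈ys₁
  ... | inj₂ (here refl)    = ⊥-elim (x≢z refl)
  ... | inj₂ (there z∈ys₂) = ∈-++⁺ʳ ys₁ z∈ys₂

unique-map⁺-local : ∀ {X Y : Set} {P : X → Set} (f : X → Y) {xs} → All P xs →
  (∀ {x y} → P x → P y → f x ≡ f y → x ≡ y) → Unique xs → Unique (map f xs)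
unique-map⁺-local f []         _   []           = []
unique-map⁺-local f (px ∷ pxs) inj (x∉xs ∷ uxs) =
  AllP.map⁺ (All.zipWith (λ (py , x≢y) fx≡fy → x≢y (inj px py fx≡fy)) (pxs , x∉xs)) ∷ unique-map⁺-local f pxs inj uxs

-- Lists of distinct representations

IsRep : ∀ {q} → Vec (List ℤ) q → Vec ℕ q → ℤ → List (List ℤ) → Set
IsRep A h n T = Chromatic A h T × totalSum T ≡ n

record Reps {q} (t : ℕ) (A : Vec (List ℤ) q) (h : Vec ℕ q) (n : ℤ) : Set where
  constructor reps
  field
    tuples   : List (List (List ℤ))
    distinct : Unique tuples
    enough   : t ≤ length tuples
    valid    : All (IsRep A h n) tuples

module _ {q t : ℕ} {A : Vec (List ℤ) q} {h : Vec ℕ q} {n : ℤ} where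

  sum≟n : (T : List (List ℤ)) → Dec (totalSum T ≡ n)
  sum≟n T = totalSum T ℤP.≟ n

  InRestricted⇒Reps : VAll.All Unique A → InRestricted t A h n → Reps t A h n
  InRestricted⇒Reps uA t≤ =
    reps (filter sum≟n (chromTuples A h)) (UniqueP.filter⁺ sum≟n (chromTuples-unique h uA)) t≤ (All.tabulate valid)
    where
    valid : ∀ {T} → T ∈ filter sum≟n (chromTuples A h) → IsRep A h n T
    valid T∈ = let T∈′ , sum≡ = ∈-filter⁻ sum≟n {xs = chromTuples A h} T∈ in ∈-chromTuples⁻ A h T∈′ , sum≡

  Reps⇒InRestricted : Reps t A h n → InRestricted t A h n
  Reps⇒InRestricted (reps Ts uTs t≤ valid) =
    ℕP.≤-trans t≤ (unique⊆⇒length≤ uTs (All.map (λ (c , sum≡) → ∈-filter⁺ sum≟n (∈-chromTuples⁺ c) sum≡) valid))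

  Reps⇒IsRep : 1 ≤ t → Reps t A h n → ∃[ T ] IsRep A h n T
  Reps⇒IsRep (s≤s z≤n) (reps []      _ ()  _)
  Reps⇒IsRep _         (reps (T ∷ _) _ _   (T-rep ∷ _)) = T , T-rep

  Reps-retract : ∀ {q′} {A′ : Vec (List ℤ) q′} {h′ n′} (f g : List (List ℤ) → List (List ℤ)) →
    (∀ {T} → IsRep A h n T → IsRep A′ h′ n′ (f T) × g (f T) ≡ T) → Reps t A h n → Reps t A′ h′ n′
  Reps-retract f g retract (reps Ts uTs t≤ valid) =
    reps (map f Ts) (UniqueP.map⁻ (subst Unique (sym gfTs≡Ts) uTs))
      (subst (t ≤_) (sym (length-map f Ts)) t≤) (AllP.map⁺ (All.map (proj₁ ∘ retract) valid))
    where
    gfTs≡Ts : map g (map f Ts) ≡ Ts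
    gfTs≡Ts = trans (sym (map-∘ Ts)) (map-id-local (All.map (proj₂ ∘ retract) valid))

  Reps⇒distinct-pair : 2 ≤ t → Reps t A h n → ∃[ T ] ∃[ T′ ] T ≢ T′ × IsRep A h n T × IsRep A h n T′
  Reps⇒distinct-pair (s≤s (s≤s z≤n)) (reps []       _ ()       _)
  Reps⇒distinct-pair (s≤s (s≤s z≤n)) (reps (_ ∷ []) _ (s≤s ()) _)
  Reps⇒distinct-pair _ (reps (T ∷ T′ ∷ _) ((T≢T′ ∷ _) ∷ _) _ (T-rep ∷ T′-rep ∷ _)) = T , T′ , T≢T′ , T-rep , T′-rep

-- Excess over the minimum and deficit below the maximum

IsMin : List ℤ → ℤ → Set
IsMin A m = m ∈ A × All (m ℤ.≤_) A

IsMax : List ℤ → ℤ → Set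
IsMax A M = M ∈ A × All (ℤ._≤ M) A

nonempty⇒min : ∀ {A} → Σ ℤ (_∈ A) → Σ ℤ (IsMin A)
nonempty⇒min {x ∷ xs} _ = min x xs , [ here , there ]′ (argmin-sel id x xs) , min≤⊤ x xs ∷ min≤xs x xs

nonempty⇒max : ∀ {A} → Σ ℤ (_∈ A) → Σ ℤ (IsMax A)
nonempty⇒max {x ∷ xs} _ = max x xs , [ here , there ]′ (argmax-sel id x xs) , ⊥≤max x xs ∷ xs≤max x xs

choose-pointwise : ∀ {q} {P : List ℤ → ℤ → Set} {A : Vec (List ℤ) q} →
  VAll.All (λ Ai → Σ ℤ (P Ai)) A → Σ (Vec ℤ q) (Pointwise P A)
choose-pointwise VAll.[]                = [] , []
choose-pointwise ((m , pm) VAll.∷ rest) = let ms , pms = choose-pointwise rest in m ∷ ms , pm ∷ pms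

i≤j⇒j≡i+∣j-i∣ : ∀ {i j} → i ℤ.≤ j → j ≡ i ℤ.+ + ∣ j ℤ.- i ∣
i≤j⇒j≡i+∣j-i∣ {i} {j} i≤j = begin
  j                     ≡⟨ //-rightDividesˡ i j ⟨
  (j ℤ.- i) ℤ.+ i       ≡⟨ ℤP.+-comm (j ℤ.- i) i ⟩
  i ℤ.+ (j ℤ.- i)       ≡⟨ cong (λ z → i ℤ.+ z) (ℤP.0≤i⇒+∣i∣≡i (ℤP.i≤j⇒0≤j-i i≤j)) ⟨
  i ℤ.+ + ∣ j ℤ.- i ∣   ∎
  where open ≡-Reasoning

i<j⇒0<∣j-i∣ : ∀ {i j} → i ℤ.< j → 0 < ∣ j ℤ.- i ∣
i<j⇒0<∣j-i∣ {i} {j} i<j = ℕP.n≢0⇒n>0 λ ∣j-i∣≡0 →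
  ℤP.<-irrefl (sym (trans (i≤j⇒j≡i+∣j-i∣ (ℤP.<⇒≤ i<j)) (trans (cong (λ g → i ℤ.+ + g) ∣j-i∣≡0) (ℤP.+-identityʳ i)))) i<j

∣i-i∣≡0 : ∀ i → ∣ i ℤ.- i ∣ ≡ 0
∣i-i∣≡0 i = cong ∣_∣ (ℤP.+-inverseʳ i)

excess : ℤ → List ℤ → ℕ
excess m []      = 0
excess m (a ∷ v) = ∣ a ℤ.- m ∣ ℕ.+ excess m v

deficit : ℤ → List ℤ → ℕ
deficit M []      = 0
deficit M (a ∷ v) = ∣ M ℤ.- a ∣ ℕ.+ deficit M v

sum≡length*min+excess : ∀ {m} v → All (m ℤ.≤_) v → sumℤ v ≡ + length v ℤ.* m ℤ.+ + excess m v
sum≡length*min+excess     []      []          = refl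
sum≡length*min+excess {m} (a ∷ v) (m≤a ∷ m≤v) = begin
  a ℤ.+ sumℤ v                                                   ≡⟨ cong₂ ℤ._+_ (i≤j⇒j≡i+∣j-i∣ m≤a) (sum≡length*min+excess v m≤v) ⟩
  (m ℤ.+ + ∣ a ℤ.- m ∣) ℤ.+ (+ length v ℤ.* m ℤ.+ + excess m v) ≡⟨ interchange m (+ ∣ a ℤ.- m ∣) (+ length v ℤ.* m) (+ excess m v) ⟩
  (m ℤ.+ + length v ℤ.* m) ℤ.+ + excess m (a ∷ v)               ≡⟨ cong (ℤ._+ + excess m (a ∷ v)) (ℤP.suc-* (+ length v) m) ⟨
  + length (a ∷ v) ℤ.* m ℤ.+ + excess m (a ∷ v)                  ∎
  where open ≡-Reasoning

sum+deficit≡length*max : ∀ {M} v → All (ℤ._≤ M) v → sumℤ v ℤ.+ + deficit M v ≡ + length v ℤ.* M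
sum+deficit≡length*max     []      []          = refl
sum+deficit≡length*max {M} (a ∷ v) (a≤M ∷ v≤M) = begin
  (a ℤ.+ sumℤ v) ℤ.+ + deficit M (a ∷ v)                           ≡⟨ interchange a (sumℤ v) (+ ∣ M ℤ.- a ∣) (+ deficit M v) ⟩
  (a ℤ.+ + ∣ M ℤ.- a ∣) ℤ.+ (sumℤ v ℤ.+ + deficit M v)             ≡⟨ cong₂ ℤ._+_ (i≤j⇒j≡i+∣j-i∣ a≤M) (sym (sum+deficit≡length*max v v≤M)) ⟨
  M ℤ.+ + length v ℤ.* M                                            ≡⟨ ℤP.suc-* (+ length v) M ⟨
  + length (a ∷ v) ℤ.* M                                            ∎
  where open ≡-Reasoning

length*min≤sum : ∀ {m} v → All (m ℤ.≤_) v → + length v ℤ.* m ℤ.≤ sumℤ v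
length*min≤sum {m} v m≤v = ℤP.≤-trans (ℤP.i≤i+j _ (+ excess m v)) (ℤP.≤-reflexive (sym (sum≡length*min+excess v m≤v)))

sum≤length*max : ∀ {M} v → All (ℤ._≤ M) v → sumℤ v ℤ.≤ + length v ℤ.* M
sum≤length*max {M} v v≤M = ℤP.≤-trans (ℤP.i≤i+j _ (+ deficit M v)) (ℤP.≤-reflexive (sum+deficit≡length*max v v≤M))

length≤excess : ∀ {m} v → All (m ℤ.<_) v → length v ≤ excess m v
length≤excess []      []          = z≤n
length≤excess (_ ∷ v) (m<a ∷ m<v) = ℕP.+-mono-≤ (i<j⇒0<∣j-i∣ m<a) (length≤excess v m<v)

excess-divisible : ∀ {D A m v} → (∀ {a} → a ∈ A → D ∣ ∣ a ℤ.- m ∣) → All (_∈ A) v → D ∣ excess m v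
excess-divisible D∣ []          = divides 0 refl
excess-divisible D∣ (a∈ ∷ v⊆) = ∣m∣n⇒∣m+n (D∣ a∈) (excess-divisible D∣ v⊆)

-- Each entry above m adds at least 1 to the excess, so only the last excess m v entries exceed m.
row-prefix : ∀ {m} k v → Sorted v → All (m ℤ.≤_) v → k ℕ.+ excess m v ≤ length v →
  v ≡ replicate k m ++ drop k v
row-prefix zero    v       _             _           _     = refl
row-prefix (suc k) []      _             _           ()
row-prefix {m} (suc k) (x ∷ v) (x≤v ∷ v↗) (m≤x ∷ m≤v) bound with x ℤ.≟ m
... | yes refl = cong (x ∷_) (row-prefix k v v↗ m≤v
      (ℕ.s≤s⁻¹ (subst (λ g → suc k ℕ.+ (g ℕ.+ excess x v) ≤ suc (length v)) (∣i-i∣≡0 x) bound)))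
... | no x≢m = ⊥-elim (ℕP.<⇒≱ (ℕP.<-≤-trans (ℕP.m<n+m (excess m (x ∷ v)) {suc k} z<s) bound)
      (length≤excess (x ∷ v) (m<x ∷ All.map (ℤP.<-≤-trans m<x) x≤v)))
  where
  m<x : m ℤ.< x
  m<x = ℤP.≤∧≢⇒< m≤x (x≢m ∘′ sym)

all≡⇒≡replicate : ∀ {X : Set} {x : X} {v} → All (_≡ x) v → v ≡ replicate (length v) x
all≡⇒≡replicate []           = refl
all≡⇒≡replicate (refl ∷ v≡x) = cong (_ ∷_) (all≡⇒≡replicate v≡x)

drop-replicate : ∀ {X : Set} h k (x : X) → drop h (replicate (h ℕ.+ k) x) ≡ replicate k x
drop-replicate zero    k x = refl
drop-replicate (suc h) k x = drop-replicate h k x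

row-suffix : ∀ {M} h k v → Sorted v → All (ℤ._≤ M) v → length v ≡ h ℕ.+ k → k ℕ.+ deficit M v ≤ length v →
  drop h v ≡ replicate k M
row-suffix zero    zero    []      _          _           _   _     = refl
row-suffix {M} h k (x ∷ v) (x≤v ∷ v↗) (x≤M ∷ v≤M) len bound with x ℤ.≟ M
... | yes refl = trans (cong (drop h) (trans (all≡⇒≡replicate all≡x) (cong (λ n → replicate n x) len))) (drop-replicate h k x)
  where
  all≡x : All (_≡ x) (x ∷ v)
  all≡x = refl ∷ All.zipWith (λ (x≤a , a≤x) → ℤP.≤-antisym a≤x x≤a) (x≤v , v≤M)
... | no x≢M = below-max h len bound
  where
  0<gap : 0 < ∣ M ℤ.- x ∣
  0<gap = i<j⇒0<∣j-i∣ (ℤP.≤∧≢⇒< x≤M x≢M)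
  below-max : ∀ h → suc (length v) ≡ h ℕ.+ k → k ℕ.+ deficit M (x ∷ v) ≤ suc (length v) → drop h (x ∷ v) ≡ replicate k M
  below-max zero    len bound =
    ⊥-elim (ℕP.<⇒≱ (ℕP.m<m+n k (ℕP.<-≤-trans 0<gap (ℕP.m≤m+n _ _))) (ℕP.≤-trans bound (ℕP.≤-reflexive len)))
  below-max (suc h) len bound = row-suffix h k v v↗ v≤M (ℕP.suc-injective len) (ℕ.s≤s⁻¹ (begin
    suc (k ℕ.+ deficit M v)             ≡⟨ ℕP.+-suc k _ ⟨
    k ℕ.+ suc (deficit M v)             ≤⟨ ℕP.+-monoʳ-≤ k (ℕP.+-monoˡ-≤ _ 0<gap) ⟩
    k ℕ.+ deficit M (x ∷ v)             ≤⟨ bound ⟩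
    suc (length v)                      ∎))
    where open ℕP.≤-Reasoning

_+ᵛ_ : ∀ {q} → Vec ℕ q → Vec ℕ q → Vec ℕ q
_+ᵛ_ = Vec.zipWith ℕ._+_

dot : ∀ {q} → Vec ℕ q → Vec ℤ q → ℤ
dot []       []       = + 0
dot (k ∷ ks) (m ∷ ms) = + k ℤ.* m ℤ.+ dot ks ms

dot-+ᵛ : ∀ {q} (h k : Vec ℕ q) ms → dot (h +ᵛ k) ms ≡ dot h ms ℤ.+ dot k ms
dot-+ᵛ []      []      []       = refl
dot-+ᵛ (a ∷ h) (b ∷ k) (m ∷ ms) = begin
  + (a ℕ.+ b) ℤ.* m ℤ.+ dot (h +ᵛ k) ms                      ≡⟨ cong₂ ℤ._+_ (ℤP.*-distribʳ-+ m (+ a) (+ b)) (dot-+ᵛ h k ms) ⟩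
  (+ a ℤ.* m ℤ.+ + b ℤ.* m) ℤ.+ (dot h ms ℤ.+ dot k ms)     ≡⟨ interchange (+ a ℤ.* m) _ _ _ ⟩
  (+ a ℤ.* m ℤ.+ dot h ms) ℤ.+ (+ b ℤ.* m ℤ.+ dot k ms)     ∎
  where open ≡-Reasoning

dot-updateAt-suc : ∀ {q} (i : Fin q) h ms → dot (h [ i ]%= suc) ms ≡ lookup ms i ℤ.+ dot h ms
dot-updateAt-suc zero    (k ∷ h) (m ∷ ms) = trans (cong (ℤ._+ dot h ms) (ℤP.suc-* (+ k) m)) (ℤP.+-assoc m (+ k ℤ.* m) (dot h ms))
dot-updateAt-suc (suc i) (k ∷ h) (m ∷ ms) =
  trans (cong (λ s → + k ℤ.* m ℤ.+ s) (dot-updateAt-suc i h ms)) (x∙yz≈y∙xz (+ k ℤ.* m) (lookup ms i) (dot h ms))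

dot-zero : ∀ {q} (ms : Vec ℤ q) → dot (Vec.replicate q 0) ms ≡ + 0
dot-zero []       = refl
dot-zero (m ∷ ms) = trans (ℤP.+-identityˡ _) (dot-zero ms)

updateAt-suc-bounded : ∀ {q n} (i : Fin q) {h : Vec ℕ q} → VAll.All (_≤ n) h → VAll.All (_≤ suc n) (h [ i ]%= suc)
updateAt-suc-bounded zero    (k≤n VAll.∷ h≤n) = s≤s k≤n VAll.∷ VAll.map ℕP.m≤n⇒m≤1+n h≤n
updateAt-suc-bounded (suc i) (k≤n VAll.∷ h≤n) = ℕP.m≤n⇒m≤1+n k≤n VAll.∷ updateAt-suc-bounded i h≤n

c+ᵛ[C∸c]≡C : ∀ {q} C {c : Vec ℕ q} → VAll.All (_≤ C) c → c +ᵛ Vec.map (C ℕ.∸_) c ≡ Vec.replicate q C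
c+ᵛ[C∸c]≡C C VAll.[]              = refl
c+ᵛ[C∸c]≡C C (k≤C VAll.∷ c≤C) = cong₂ _∷_ (ℕP.m+[n∸m]≡n k≤C) (c+ᵛ[C∸c]≡C C c≤C)

dotℕ : ∀ {q} → Vec ℕ q → Vec ℕ q → ℕ
dotℕ []       []       = 0
dotℕ (a ∷ as) (d ∷ δ) = a ℕ.* d ℕ.+ dotℕ as δ

dotℕ-+ᵛ : ∀ {q} (h k δ : Vec ℕ q) → dotℕ (h +ᵛ k) δ ≡ dotℕ h δ ℕ.+ dotℕ k δ
dotℕ-+ᵛ []      []      []      = refl
dotℕ-+ᵛ (a ∷ h) (b ∷ k) (d ∷ δ) = trans (cong₂ ℕ._+_ (ℕP.*-distribʳ-+ d a b) (dotℕ-+ᵛ h k δ)) (ℕ-+.interchange (a ℕ.* d) _ _ _)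

dotℕ-scale : ∀ {q} r (h δ : Vec ℕ q) → dotℕ (Vec.map (r ℕ.*_) h) δ ≡ r ℕ.* dotℕ h δ
dotℕ-scale r []      []      = sym (ℕP.*-zeroʳ r)
dotℕ-scale r (a ∷ h) (d ∷ δ) = trans (cong₂ ℕ._+_ (ℕP.*-assoc r a d) (dotℕ-scale r h δ)) (sym (ℕP.*-distribˡ-+ r (a ℕ.* d) _))

dotℕ-monoˡ-≤ : ∀ {q} {h k : Vec ℕ q} δ → Pointwise _≤_ h k → dotℕ h δ ≤ dotℕ k δ
dotℕ-monoˡ-≤ []      []          = z≤n
dotℕ-monoˡ-≤ (d ∷ δ) (a≤b ∷ h≤k) = ℕP.+-mono-≤ (ℕP.*-monoˡ-≤ d a≤b) (dotℕ-monoˡ-≤ δ h≤k)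

unit : ∀ {q} → Fin q → Vec ℕ q
unit {q} i = Vec.replicate q 0 [ i ]%= suc

+ᵛ-unit : ∀ {q} (h : Vec ℕ q) i → h +ᵛ unit i ≡ h [ i ]%= suc
+ᵛ-unit (a ∷ h) zero    = cong₂ _∷_ (ℕP.+-comm a 1) (zipWith-identityʳ ℕP.+-identityʳ h)
+ᵛ-unit (a ∷ h) (suc i) = cong₂ _∷_ (ℕP.+-identityʳ a) (+ᵛ-unit h i)

unit≤ones : ∀ {q} (i : Fin q) → Pointwise _≤_ (unit i) (Vec.replicate q 1)
unit≤ones {suc q} zero    = ℕP.≤-refl ∷ zeros≤ones q
  where
  zeros≤ones : ∀ n → Pointwise _≤_ (Vec.replicate n 0) (Vec.replicate n 1)
  zeros≤ones zero    = []
  zeros≤ones (suc n) = z≤n ∷ zeros≤ones n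
unit≤ones (suc i) = z≤n ∷ unit≤ones i

dot-shift : ∀ {q} D (ms Ms : Vec ℤ q) δ → (∀ i → lookup Ms i ≡ lookup ms i ℤ.+ + (D ℕ.* lookup δ i)) →
  ∀ k → dot k Ms ≡ dot k ms ℤ.+ + (D ℕ.* dotℕ k δ)
dot-shift D []       []       []      _     []       = cong +_ (sym (ℕP.*-zeroʳ D))
dot-shift D (m ∷ ms) (M ∷ Ms) (d ∷ δ) shift (a ∷ k) = begin
  + a ℤ.* M ℤ.+ dot k Ms
    ≡⟨ cong₂ ℤ._+_ (cong (+ a ℤ.*_) (shift zero)) (dot-shift D ms Ms δ (shift ∘ suc) k) ⟩
  + a ℤ.* (m ℤ.+ + (D ℕ.* d)) ℤ.+ (dot k ms ℤ.+ + (D ℕ.* dotℕ k δ))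
    ≡⟨ cong (ℤ._+ _) (ℤP.*-distribˡ-+ (+ a) m _) ⟩
  (+ a ℤ.* m ℤ.+ + a ℤ.* + (D ℕ.* d)) ℤ.+ (dot k ms ℤ.+ + (D ℕ.* dotℕ k δ))
    ≡⟨ interchange (+ a ℤ.* m) _ (dot k ms) _ ⟩
  (+ a ℤ.* m ℤ.+ dot k ms) ℤ.+ (+ a ℤ.* + (D ℕ.* d) ℤ.+ + (D ℕ.* dotℕ k δ))
    ≡⟨ cong (λ z → (+ a ℤ.* m ℤ.+ dot k ms) ℤ.+ (z ℤ.+ + (D ℕ.* dotℕ k δ))) (ℤP.pos-* a (D ℕ.* d)) ⟨
  (+ a ℤ.* m ℤ.+ dot k ms) ℤ.+ + (a ℕ.* (D ℕ.* d) ℕ.+ D ℕ.* dotℕ k δ)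
    ≡⟨ cong (λ z → (+ a ℤ.* m ℤ.+ dot k ms) ℤ.+ + z) (rearrange a (dotℕ k δ)) ⟩
  (+ a ℤ.* m ℤ.+ dot k ms) ℤ.+ + (D ℕ.* (a ℕ.* d ℕ.+ dotℕ k δ))
    ∎
  where
  open ≡-Reasoning
  rearrange : ∀ a e → a ℕ.* (D ℕ.* d) ℕ.+ D ℕ.* e ≡ D ℕ.* (a ℕ.* d ℕ.+ e)
  rearrange a e = trans (cong (ℕ._+ D ℕ.* e) (ℕ-*.x∙yz≈y∙xz a D d)) (sym (ℕP.*-distribˡ-+ D (a ℕ.* d) e))

scale-suc : ∀ {q} r (h : Vec ℕ q) → scale (suc r) h ≡ h +ᵛ scale r h
scale-suc r []      = refl
scale-suc r (a ∷ h) = cong (a ℕ.+ r ℕ.* a ∷_) (scale-suc r h)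

excessᵀ : ∀ {q} → Vec ℤ q → List (List ℤ) → ℕ
excessᵀ []       _       = 0
excessᵀ (m ∷ ms) []      = 0
excessᵀ (m ∷ ms) (v ∷ T) = excess m v ℕ.+ excessᵀ ms T

deficitᵀ : ∀ {q} → Vec ℤ q → List (List ℤ) → ℕ
deficitᵀ []       _       = 0
deficitᵀ (M ∷ Ms) []      = 0
deficitᵀ (M ∷ Ms) (v ∷ T) = deficit M v ℕ.+ deficitᵀ Ms T

bounded-below : ∀ {A m v} → IsMin A m → All (_∈ A) v → All (m ℤ.≤_) v
bounded-below (_ , m≤A) = All.map (All.lookup m≤A)

bounded-above : ∀ {A M v} → IsMax A M → All (_∈ A) v → All (ℤ._≤ M) v
bounded-above (_ , A≤M) = All.map (All.lookup A≤M)

totalSum≡dot+excess : ∀ {q} {A : Vec (List ℤ) q} {ms h T} → Pointwise IsMin A ms → Chromatic A h T →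
  totalSum T ≡ dot h ms ℤ.+ + excessᵀ ms T
totalSum≡dot+excess []            []                            = refl
totalSum≡dot+excess {ms = m ∷ ms} (least ∷ imin) (_∷_ {k = k} {v = v} {T = T} (row refl v⊆ _) c) =
  trans (cong₂ ℤ._+_ (sum≡length*min+excess v (bounded-below least v⊆)) (totalSum≡dot+excess imin c))
        (interchange (+ k ℤ.* m) (+ excess m v) _ (+ excessᵀ ms T))

totalSum+deficit≡dot : ∀ {q} {A : Vec (List ℤ) q} {Ms h T} → Pointwise IsMax A Ms → Chromatic A h T →
  totalSum T ℤ.+ + deficitᵀ Ms T ≡ dot h Ms
totalSum+deficit≡dot []            []                            = refl
totalSum+deficit≡dot {Ms = M ∷ Ms} (greatest ∷ imax) (_∷_ {v = v} {T = T} (row refl v⊆ _) c) =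
  trans (interchange (sumℤ v) (totalSum T) (+ deficit M v) (+ deficitᵀ Ms T))
        (cong₂ ℤ._+_ (sum+deficit≡length*max v (bounded-above greatest v⊆)) (totalSum+deficit≡dot imax c))

excessᵀ-divisible : ∀ {q D} {A : Vec (List ℤ) q} {ms h T} → (∀ i {a} → a ∈ lookup A i → D ∣ ∣ a ℤ.- lookup ms i ∣) →
  Chromatic A h T → D ∣ excessᵀ ms T
excessᵀ-divisible {ms = []}    D∣ []                     = divides 0 refl
excessᵀ-divisible {ms = _ ∷ ms} D∣ (row _ v⊆ _ ∷ c) = ∣m∣n⇒∣m+n (excess-divisible (D∣ zero) v⊆) (excessᵀ-divisible {ms = ms} (D∣ ∘ suc) c)

-- Padding rows with minima and maxima

sumℤ-++ : ∀ u v → sumℤ (u ++ v) ≡ sumℤ u ℤ.+ sumℤ v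
sumℤ-++ []      v = sym (ℤP.+-identityˡ (sumℤ v))
sumℤ-++ (a ∷ u) v = trans (cong (λ s → a ℤ.+ s) (sumℤ-++ u v)) (sym (ℤP.+-assoc a (sumℤ u) (sumℤ v)))

sumℤ-replicate : ∀ k x → sumℤ (replicate k x) ≡ + k ℤ.* x
sumℤ-replicate zero    x = refl
sumℤ-replicate (suc k) x = trans (cong (λ s → x ℤ.+ s) (sumℤ-replicate k x)) (sym (ℤP.suc-* (+ k) x))

replicate-sorted : ∀ k x → Sorted (replicate k x)
replicate-sorted zero    x = []
replicate-sorted (suc k) x = AllP.replicate⁺ k ℤP.≤-refl ∷ replicate-sorted k x

prependMins : ∀ {q} → Vec ℤ q → Vec ℕ q → List (List ℤ) → List (List ℤ)
prependMins []       []       T       = T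
prependMins (m ∷ ms) (k ∷ ks) []      = []
prependMins (m ∷ ms) (k ∷ ks) (v ∷ T) = (replicate k m ++ v) ∷ prependMins ms ks T

dropEach : ∀ {q} → Vec ℕ q → List (List ℤ) → List (List ℤ)
dropEach []       T       = T
dropEach (k ∷ ks) []      = []
dropEach (k ∷ ks) (v ∷ T) = drop k v ∷ dropEach ks T

appendMaxs : ∀ {q} → Vec ℤ q → Vec ℕ q → List (List ℤ) → List (List ℤ)
appendMaxs []       []       T       = T
appendMaxs (M ∷ Ms) (k ∷ ks) []      = []
appendMaxs (M ∷ Ms) (k ∷ ks) (v ∷ T) = (v ++ replicate k M) ∷ appendMaxs Ms ks T

takeEach : ∀ {q} → Vec ℕ q → List (List ℤ) → List (List ℤ)
takeEach []       T       = T
takeEach (h ∷ hs) []      = []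
takeEach (h ∷ hs) (v ∷ T) = take h v ∷ takeEach hs T

drop-replicate-++ : ∀ {X : Set} k (x : X) v → drop k (replicate k x ++ v) ≡ v
drop-replicate-++ zero    x v = refl
drop-replicate-++ (suc k) x v = drop-replicate-++ k x v

take-length-++ : ∀ {X : Set} (u w : List X) → take (length u) (u ++ w) ≡ u
take-length-++ []      w = refl
take-length-++ (x ∷ u) w = cong (x ∷_) (take-length-++ u w)

prependMins-chromatic : ∀ {q} {A : Vec (List ℤ) q} {ms h T} (ks : Vec ℕ q) → Pointwise IsMin A ms → Chromatic A h T →
  Chromatic A (h +ᵛ ks) (prependMins ms ks T)
prependMins-chromatic []       []           []                            = []
prependMins-chromatic (k ∷ ks) (least ∷ imin) (_∷_ {v = v} (row refl v⊆ v↗) c) =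
  row (trans (length-++ (replicate k _)) (trans (cong (ℕ._+ length v) (length-replicate k)) (ℕP.+-comm k _)))
      (AllP.++⁺ (AllP.replicate⁺ k (proj₁ least)) v⊆)
      (AllPairsP.++⁺ (replicate-sorted k _) v↗ (AllP.replicate⁺ k (bounded-below least v⊆)))
  ∷ prependMins-chromatic ks imin c

appendMaxs-chromatic : ∀ {q} {A : Vec (List ℤ) q} {Ms h T} (ks : Vec ℕ q) → Pointwise IsMax A Ms → Chromatic A h T →
  Chromatic A (h +ᵛ ks) (appendMaxs Ms ks T)
appendMaxs-chromatic []       []           []                            = []
appendMaxs-chromatic (k ∷ ks) (greatest ∷ imax) (_∷_ {v = v} (row refl v⊆ v↗) c) =
  row (trans (length-++ v) (cong (length v ℕ.+_) (length-replicate k)))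
      (AllP.++⁺ v⊆ (AllP.replicate⁺ k (proj₁ greatest)))
      (AllPairsP.++⁺ v↗ (replicate-sorted k _) (All.map (AllP.replicate⁺ k) (bounded-above greatest v⊆)))
  ∷ appendMaxs-chromatic ks imax c

totalSum-prependMins : ∀ {q} {A : Vec (List ℤ) q} {h T} → Chromatic A h T → (ms : Vec ℤ q) (ks : Vec ℕ q) →
  totalSum (prependMins ms ks T) ≡ dot ks ms ℤ.+ totalSum T
totalSum-prependMins []       []       []                  = refl
totalSum-prependMins (_∷_ {v = v} {T = T} _ c) (m ∷ ms) (k ∷ ks) =
  trans (cong₂ ℤ._+_ (trans (sumℤ-++ (replicate k m) v) (cong (ℤ._+ sumℤ v) (sumℤ-replicate k m)))
                      (totalSum-prependMins c ms ks))
        (interchange (+ k ℤ.* m) (sumℤ v) (dot ks ms) (totalSum T))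

totalSum-appendMaxs : ∀ {q} {A : Vec (List ℤ) q} {h T} → Chromatic A h T → (Ms : Vec ℤ q) (ks : Vec ℕ q) →
  totalSum (appendMaxs Ms ks T) ≡ dot ks Ms ℤ.+ totalSum T
totalSum-appendMaxs []       []       []                  = refl
totalSum-appendMaxs (_∷_ {v = v} {T = T} _ c) (M ∷ Ms) (k ∷ ks) =
  trans (cong₂ ℤ._+_ (trans (sumℤ-++ v (replicate k M)) (trans (cong (λ s → sumℤ v ℤ.+ s) (sumℤ-replicate k M)) (ℤP.+-comm (sumℤ v) _)))
                      (totalSum-appendMaxs c Ms ks))
        (interchange (+ k ℤ.* M) (sumℤ v) (dot ks Ms) (totalSum T))

dropEach-prependMins : ∀ {q} {A : Vec (List ℤ) q} {h T} → Chromatic A h T → (ms : Vec ℤ q) (ks : Vec ℕ q) →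
  dropEach ks (prependMins ms ks T) ≡ T
dropEach-prependMins []       []       []                  = refl
dropEach-prependMins (_∷_ {v = v} _ c) (m ∷ ms) (k ∷ ks) = cong₂ _∷_ (drop-replicate-++ k m v) (dropEach-prependMins c ms ks)

takeEach-appendMaxs : ∀ {q} {A : Vec (List ℤ) q} {h T} → Chromatic A h T → (Ms : Vec ℤ q) (ks : Vec ℕ q) →
  takeEach h (appendMaxs Ms ks T) ≡ T
takeEach-appendMaxs []       []       []                             = refl
takeEach-appendMaxs (_∷_ {v = v} (row refl _ _) c) (M ∷ Ms) (k ∷ ks) = cong₂ _∷_ (take-length-++ v _) (takeEach-appendMaxs c Ms ks)

prependMins-dropEach : ∀ {q} {A : Vec (List ℤ) q} {ms h T e} (ks : Vec ℕ q) → Pointwise IsMin A ms → VAll.All (e ≤_) h →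
  Chromatic A (h +ᵛ ks) T → excessᵀ ms T ≤ e → prependMins ms ks (dropEach ks T) ≡ T × Chromatic A h (dropEach ks T)
prependMins-dropEach []       []           VAll.[]           []                              _     = refl , []
prependMins-dropEach {ms = m ∷ _} {a ∷ _} {e = e} (k ∷ ks) (least ∷ imin) (e≤a VAll.∷ e≤h) (_∷_ {v = v} (row len v⊆ v↗) c) bound
  with T≡ , c′ ← prependMins-dropEach ks imin e≤h c (ℕP.m+n≤o⇒n≤o (excess m v) bound) =
  cong₂ _∷_ (sym (row-prefix k v v↗ (bounded-below least v⊆) k+excess≤length)) T≡ ,
  row (trans (length-drop k v) (trans (cong (ℕ._∸ k) len) (ℕP.m+n∸n≡m a k))) (AllP.drop⁺ k v⊆) (AllPairsP.drop⁺ k v↗) ∷ c′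
  where
  open ℕP.≤-Reasoning
  k+excess≤length : k ℕ.+ excess m v ≤ length v
  k+excess≤length = begin
    k ℕ.+ excess m v ≤⟨ ℕP.+-monoʳ-≤ k (ℕP.≤-trans (ℕP.m+n≤o⇒m≤o (excess m v) bound) e≤a) ⟩
    k ℕ.+ a          ≡⟨ ℕP.+-comm k a ⟩
    a ℕ.+ k          ≡⟨ len ⟨
    length v         ∎

appendMaxs-takeEach : ∀ {q} {A : Vec (List ℤ) q} {Ms h T e} (ks : Vec ℕ q) → Pointwise IsMax A Ms → VAll.All (e ≤_) h →
  Chromatic A (h +ᵛ ks) T → deficitᵀ Ms T ≤ e → appendMaxs Ms ks (takeEach h T) ≡ T × Chromatic A h (takeEach h T)
appendMaxs-takeEach []       []           VAll.[]           []                              _     = refl , []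
appendMaxs-takeEach {Ms = M ∷ _} {a ∷ _} {e = e} (k ∷ ks) (greatest ∷ imax) (e≤a VAll.∷ e≤h) (_∷_ {v = v} (row len v⊆ v↗) c) bound
  with T≡ , c′ ← appendMaxs-takeEach ks imax e≤h c (ℕP.m+n≤o⇒n≤o (deficit M v) bound) =
  cong₂ _∷_ (trans (cong (take a v ++_) (sym (row-suffix a k v v↗ (bounded-above greatest v⊆) len k+deficit≤length)))
                   (take++drop≡id a v)) T≡ ,
  row (trans (length-take a v) (trans (cong (a ℕ.⊓_) len) (ℕP.m≤n⇒m⊓n≡m (ℕP.m≤m+n a k))))
      (AllP.take⁺ a v⊆) (AllPairsP.take⁺ a v↗) ∷ c′
  where
  open ℕP.≤-Reasoning
  k+deficit≤length : k ℕ.+ deficit M v ≤ length v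
  k+deficit≤length = begin
    k ℕ.+ deficit M v ≤⟨ ℕP.+-monoʳ-≤ k (ℕP.≤-trans (ℕP.m+n≤o⇒m≤o (deficit M v) bound) e≤a) ⟩
    k ℕ.+ a           ≡⟨ ℕP.+-comm k a ⟩
    a ℕ.+ k           ≡⟨ len ⟨
    length v          ∎

excessᵀ-determined : ∀ {q} {A : Vec (List ℤ) q} {ms h T x} → Pointwise IsMin A ms → Chromatic A h T →
  totalSum T ≡ dot h ms ℤ.+ + x → excessᵀ ms T ≡ x
excessᵀ-determined {ms = ms} {h} imin c sum≡ =
  ℤP.+-injective (∙-cancelˡ (dot h ms) _ _ (trans (sym (totalSum≡dot+excess imin c)) sum≡))

deficitᵀ-determined : ∀ {q} {A : Vec (List ℤ) q} {Ms h T y} → Pointwise IsMax A Ms → Chromatic A h T →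
  totalSum T ℤ.+ + y ≡ dot h Ms → deficitᵀ Ms T ≡ y
deficitᵀ-determined {T = T} imax c sum≡ =
  ℤP.+-injective (∙-cancelˡ (totalSum T) _ _ (trans (totalSum+deficit≡dot imax c) (sym sum≡)))

module _ {q : ℕ} {A : Vec (List ℤ) q} {t : ℕ} where

  Reps-prependMins : ∀ {ms h n} ks → Pointwise IsMin A ms → Reps t A h n → Reps t A (h +ᵛ ks) (dot ks ms ℤ.+ n)
  Reps-prependMins {ms} ks imin = Reps-retract (prependMins ms ks) (dropEach ks) λ (c , sum≡) →
    (prependMins-chromatic ks imin c , trans (totalSum-prependMins c ms ks) (cong (λ s → dot ks ms ℤ.+ s) sum≡)) ,
    dropEach-prependMins c ms ks

  Reps-appendMaxs : ∀ {Ms h n} ks → Pointwise IsMax A Ms → Reps t A h n → Reps t A (h +ᵛ ks) (dot ks Ms ℤ.+ n)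
  Reps-appendMaxs {Ms} ks imax = Reps-retract (appendMaxs Ms ks) (takeEach _) λ (c , sum≡) →
    (appendMaxs-chromatic ks imax c , trans (totalSum-appendMaxs c Ms ks) (cong (λ s → dot ks Ms ℤ.+ s) sum≡)) ,
    takeEach-appendMaxs c Ms ks

  Reps-dropMins : ∀ {ms h e x} ks → Pointwise IsMin A ms → VAll.All (e ≤_) h → x ≤ e →
    Reps t A (h +ᵛ ks) (dot ks ms ℤ.+ (dot h ms ℤ.+ + x)) → Reps t A h (dot h ms ℤ.+ + x)
  Reps-dropMins {ms} {h} {x = x} ks imin e≤h x≤e = Reps-retract (dropEach ks) (prependMins ms ks) retract
    where
    retract : ∀ {T} → IsRep A (h +ᵛ ks) (dot ks ms ℤ.+ (dot h ms ℤ.+ + x)) T →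
      IsRep A h (dot h ms ℤ.+ + x) (dropEach ks T) × prependMins ms ks (dropEach ks T) ≡ T
    retract {T} (c , sum≡) =
      (c′ , ∙-cancelˡ (dot ks ms) _ _ (trans (sym (trans (cong totalSum (sym T≡)) (totalSum-prependMins c′ ms ks))) sum≡)) , T≡
      where
      excess≡ : excessᵀ ms T ≡ x
      excess≡ = excessᵀ-determined imin c (trans sum≡ (trans (x∙yz≈yx∙z (dot ks ms) (dot h ms) (+ x))
                                                             (cong (ℤ._+ + x) (sym (dot-+ᵛ h ks ms)))))
      recovered : prependMins ms ks (dropEach ks T) ≡ T × Chromatic A h (dropEach ks T)
      recovered = prependMins-dropEach ks imin e≤h c (subst (_≤ _) (sym excess≡) x≤e)
      T≡ = proj₁ recovered
      c′ = proj₂ recovered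

  Reps-takeMaxs : ∀ {Ms h e s y} ks → Pointwise IsMax A Ms → VAll.All (e ≤_) h → y ≤ e → s ℤ.+ + y ≡ dot h Ms →
    Reps t A (h +ᵛ ks) (dot ks Ms ℤ.+ s) → Reps t A h s
  Reps-takeMaxs {Ms} {h} {s = s} {y} ks imax e≤h y≤e s+y≡ = Reps-retract (takeEach h) (appendMaxs Ms ks) retract
    where
    retract : ∀ {T} → IsRep A (h +ᵛ ks) (dot ks Ms ℤ.+ s) T → IsRep A h s (takeEach h T) × appendMaxs Ms ks (takeEach h T) ≡ T
    retract {T} (c , sum≡) =
      (c′ , ∙-cancelˡ (dot ks Ms) _ _ (trans (sym (trans (cong totalSum (sym T≡)) (totalSum-appendMaxs c′ Ms ks))) sum≡)) , T≡
      where
      deficit≡ : deficitᵀ Ms T ≡ y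
      deficit≡ = deficitᵀ-determined imax c (begin
        totalSum T ℤ.+ + y              ≡⟨ cong (ℤ._+ + y) sum≡ ⟩
        (dot ks Ms ℤ.+ s) ℤ.+ + y       ≡⟨ ℤP.+-assoc (dot ks Ms) s (+ y) ⟩
        dot ks Ms ℤ.+ (s ℤ.+ + y)       ≡⟨ cong (λ z → dot ks Ms ℤ.+ z) s+y≡ ⟩
        dot ks Ms ℤ.+ dot h Ms          ≡⟨ ℤP.+-comm (dot ks Ms) (dot h Ms) ⟩
        dot h Ms ℤ.+ dot ks Ms          ≡⟨ dot-+ᵛ h ks Ms ⟨
        dot (h +ᵛ ks) Ms                ∎)
        where open ≡-Reasoning
      recovered : appendMaxs Ms ks (takeEach h T) ≡ T × Chromatic A h (takeEach h T)
      recovered = appendMaxs-takeEach ks imax e≤h c (subst (_≤ _) (sym deficit≡) y≤e)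
      T≡ = proj₁ recovered
      c′ = proj₂ recovered

-- Saturated windows

data Climb {q} (h₀ : Vec ℕ q) : Vec ℕ q → Set where
  start : Climb h₀ h₀
  step  : ∀ {h} (i : Fin q) → Climb h₀ h → Climb h₀ (h [ i ]%= suc)

climb-from-≤ : ∀ {q} {h₀ h : Vec ℕ q} → Pointwise _≤_ h₀ h → Climb h₀ h
climb-from-≤ []                          = start
climb-from-≤ {h₀ = a ∷ h₀} {b ∷ h} (a≤b ∷ h₀≤h) =
  subst (λ c → Climb (a ∷ h₀) (c ∷ h)) (ℕP.m∸n+n≡m a≤b) (raise-head (b ∸ a) (lift (climb-from-≤ h₀≤h)))
  where
  lift : ∀ {h} → Climb h₀ h → Climb (a ∷ h₀) (a ∷ h)
  lift start      = start
  lift (step i c) = step (suc i) (lift c)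
  raise-head : ∀ d {c} → Climb (a ∷ h₀) (c ∷ h) → Climb (a ∷ h₀) ((d ℕ.+ c) ∷ h)
  raise-head zero    c = c
  raise-head (suc d) c = step zero (raise-head d c)

module Saturation {q : ℕ} {A : Vec (List ℤ) q} {ms Ms : Vec ℤ q} (imin : Pointwise IsMin A ms) (imax : Pointwise IsMax A Ms)
                  (D : ℕ) (δ : Vec ℕ q) (shift : ∀ i → lookup Ms i ≡ lookup ms i ℤ.+ + (D ℕ.* lookup δ i)) (t : ℕ) where

  ε : Vec ℕ q → ℕ
  ε h = dotℕ h δ

  L : ℕ
  L = ε (Vec.replicate q 1)

  dot-Ms : ∀ k → dot k Ms ≡ dot k ms ℤ.+ + (D ℕ.* ε k)
  dot-Ms = dot-shift D ms Ms δ shift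

  excess+deficit≡ : ∀ {h T} → Chromatic A h T → excessᵀ ms T ℕ.+ deficitᵀ Ms T ≡ D ℕ.* ε h
  excess+deficit≡ {h} {T} c = ℤP.+-injective (∙-cancelˡ (dot h ms) _ _ (begin
    dot h ms ℤ.+ + (excessᵀ ms T ℕ.+ deficitᵀ Ms T)       ≡⟨ ℤP.+-assoc (dot h ms) (+ excessᵀ ms T) (+ deficitᵀ Ms T) ⟨
    (dot h ms ℤ.+ + excessᵀ ms T) ℤ.+ + deficitᵀ Ms T     ≡⟨ cong (ℤ._+ + deficitᵀ Ms T) (totalSum≡dot+excess imin c) ⟨
    totalSum T ℤ.+ + deficitᵀ Ms T                        ≡⟨ totalSum+deficit≡dot imax c ⟩
    dot h Ms                                              ≡⟨ dot-Ms h ⟩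
    dot h ms ℤ.+ + (D ℕ.* ε h)                            ∎))
    where open ≡-Reasoning

  ε-step : ∀ h i → ε (h [ i ]%= suc) ≡ ε h ℕ.+ ε (unit i)
  ε-step h i = trans (cong ε (sym (+ᵛ-unit h i))) (dotℕ-+ᵛ h (unit i) δ)

  ε-unit≤L : ∀ i → ε (unit i) ≤ L
  ε-unit≤L i = dotℕ-monoˡ-≤ δ (unit≤ones i)

  climb-ε : ∀ {h₀ h} → Climb h₀ h → ε h₀ ≤ ε h
  climb-ε start      = ℕP.≤-refl
  climb-ε (step {h} i c) = ℕP.≤-trans (climb-ε c) (ℕP.≤-trans (ℕP.m≤m+n (ε h) (ε (unit i))) (ℕP.≤-reflexive (sym (ε-step h i))))

  Reps-above : Vec ℕ q → ℕ → Set
  Reps-above h x = Reps t A h (dot h ms ℤ.+ + x)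

  Reps-above-prepend : ∀ {h x} i → Reps-above h x → Reps-above (h [ i ]%= suc) x
  Reps-above-prepend {h} {x} i R = subst (λ h′ → Reps-above h′ x) (+ᵛ-unit h i)
    (subst (Reps t A (h +ᵛ unit i)) value≡ (Reps-prependMins (unit i) imin R))
    where
    value≡ : dot (unit i) ms ℤ.+ (dot h ms ℤ.+ + x) ≡ dot (h +ᵛ unit i) ms ℤ.+ + x
    value≡ = trans (x∙yz≈yx∙z (dot (unit i) ms) (dot h ms) (+ x)) (cong (ℤ._+ + x) (sym (dot-+ᵛ h (unit i) ms)))

  Reps-above-append : ∀ {h x} i → Reps-above h x → Reps-above (h [ i ]%= suc) (D ℕ.* ε (unit i) ℕ.+ x)
  Reps-above-append {h} {x} i R = subst (λ h′ → Reps-above h′ (D ℕ.* ε (unit i) ℕ.+ x)) (+ᵛ-unit h i)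
    (subst (Reps t A (h +ᵛ unit i)) value≡ (Reps-appendMaxs (unit i) imax R))
    where
    value≡ : dot (unit i) Ms ℤ.+ (dot h ms ℤ.+ + x) ≡ dot (h +ᵛ unit i) ms ℤ.+ + (D ℕ.* ε (unit i) ℕ.+ x)
    value≡ = begin
      dot (unit i) Ms ℤ.+ (dot h ms ℤ.+ + x)                                 ≡⟨ cong (ℤ._+ (dot h ms ℤ.+ + x)) (dot-Ms (unit i)) ⟩
      (dot (unit i) ms ℤ.+ + (D ℕ.* ε (unit i))) ℤ.+ (dot h ms ℤ.+ + x)      ≡⟨ interchange (dot (unit i) ms) _ (dot h ms) _ ⟩
      (dot (unit i) ms ℤ.+ dot h ms) ℤ.+ + (D ℕ.* ε (unit i) ℕ.+ x)
        ≡⟨ cong (ℤ._+ + (D ℕ.* ε (unit i) ℕ.+ x)) (trans (ℤP.+-comm (dot (unit i) ms) (dot h ms)) (sym (dot-+ᵛ h (unit i) ms))) ⟩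
      dot (h +ᵛ unit i) ms ℤ.+ + (D ℕ.* ε (unit i) ℕ.+ x)                    ∎
      where open ≡-Reasoning

  Saturated : ℕ → ℕ → Vec ℕ q → Set
  Saturated κ κ′ h = ∀ j → κ ℕ.+ j ℕ.+ κ′ ≤ ε h → Reps-above h (D ℕ.* (κ ℕ.+ j))

  -- A value that still fits below ε h keeps its representations after prepending mᵢ; any other
  -- value is D·δᵢ above one that fits, since δᵢ ≤ L, and is reached by appending Mᵢ.
  saturated-step : ∀ {κ κ′ h} i → κ ℕ.+ L ℕ.+ κ′ ≤ ε h → Saturated κ κ′ h → Saturated κ κ′ (h [ i ]%= suc)
  saturated-step {κ} {κ′} {h} i roomy sat j j-fits = by-room (κ ℕ.+ j ℕ.+ κ′ ≤? ε h)
    where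
    δᵢ = ε (unit i)
    by-room : Dec (κ ℕ.+ j ℕ.+ κ′ ≤ ε h) → Reps-above (h [ i ]%= suc) (D ℕ.* (κ ℕ.+ j))
    by-room (yes fits)  = Reps-above-prepend i (sat j fits)
    by-room (no ¬fits) = subst (Reps-above (h [ i ]%= suc)) value≡ (Reps-above-append i (sat j′ j′-fits))
      where
      L<j : L < j
      L<j = ℕP.+-cancelˡ-< κ L j (ℕP.+-cancelʳ-< κ′ (κ ℕ.+ L) (κ ℕ.+ j) (ℕP.≤-<-trans roomy (ℕP.≰⇒> ¬fits)))
      j′ = j ∸ δᵢ
      j≡ : δᵢ ℕ.+ j′ ≡ j
      j≡ = ℕP.m+[n∸m]≡n (ℕP.≤-trans (ε-unit≤L i) (ℕP.<⇒≤ L<j))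
      j′-fits : κ ℕ.+ j′ ℕ.+ κ′ ≤ ε h
      j′-fits = ℕP.+-cancelˡ-≤ δᵢ _ _ (begin
        δᵢ ℕ.+ (κ ℕ.+ j′ ℕ.+ κ′)       ≡⟨ ℕP.+-assoc δᵢ (κ ℕ.+ j′) κ′ ⟨
        δᵢ ℕ.+ (κ ℕ.+ j′) ℕ.+ κ′       ≡⟨ cong (ℕ._+ κ′) (ℕ-+.x∙yz≈y∙xz δᵢ κ j′) ⟩
        κ ℕ.+ (δᵢ ℕ.+ j′) ℕ.+ κ′       ≡⟨ cong (λ z → κ ℕ.+ z ℕ.+ κ′) j≡ ⟩
        κ ℕ.+ j ℕ.+ κ′                  ≤⟨ j-fits ⟩
        ε (h [ i ]%= suc)               ≡⟨ ε-step h i ⟩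
        ε h ℕ.+ δᵢ                      ≡⟨ ℕP.+-comm (ε h) δᵢ ⟩
        δᵢ ℕ.+ ε h                      ∎)
        where open ℕP.≤-Reasoning
      value≡ : D ℕ.* δᵢ ℕ.+ D ℕ.* (κ ℕ.+ j′) ≡ D ℕ.* (κ ℕ.+ j)
      value≡ = trans (sym (ℕP.*-distribˡ-+ D δᵢ (κ ℕ.+ j′)))
                       (cong (D ℕ.*_) (trans (ℕ-+.x∙yz≈y∙xz δᵢ κ j′) (cong (κ ℕ.+_) j≡)))

  saturated-climb : ∀ {κ κ′ h₀ h} → κ ℕ.+ L ℕ.+ κ′ ≤ ε h₀ → Saturated κ κ′ h₀ → Climb h₀ h → Saturated κ κ′ h
  saturated-climb roomy sat start      = sat
  saturated-climb roomy sat (step i c) = saturated-step i (ℕP.≤-trans roomy (climb-ε c)) (saturated-climb roomy sat c)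

-- Bézout combinations of weighted lists

module _ {X : Set} (w : X → ℕ) where

  weight : List X → ℕ
  weight xs = sum (map w xs)

  copies : ℕ → List X → List X
  copies zero    xs = []
  copies (suc n) xs = xs ++ copies n xs

  weight-++ : ∀ xs ys → weight (xs ++ ys) ≡ weight xs ℕ.+ weight ys
  weight-++ xs ys = trans (cong sum (map-++ w xs ys)) (sum-++ (map w xs) (map w ys))

  weight-copies : ∀ n xs → weight (copies n xs) ≡ n ℕ.* weight xs
  weight-copies zero    xs = refl
  weight-copies (suc n) xs = trans (weight-++ xs (copies n xs)) (cong (weight xs ℕ.+_) (weight-copies n xs))

  weight-replicate : ∀ n x → weight (replicate n x) ≡ n ℕ.* w x
  weight-replicate zero    x = refl
  weight-replicate (suc n) x = cong (w x ℕ.+_) (weight-replicate n x)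

  copies⁺ : ∀ {P : X → Set} n {xs} → All P xs → All P (copies n xs)
  copies⁺ zero    _  = []
  copies⁺ (suc n) pxs = AllP.++⁺ pxs (copies⁺ n pxs)

  length-copies : ∀ n xs → length (copies n xs) ≡ n ℕ.* length xs
  length-copies zero    xs = refl
  length-copies (suc n) xs = trans (length-++ xs) (cong (length xs ℕ.+_) (length-copies n xs))

  record Bezout (gs : List X) : Set where
    field
      d        : ℕ
      d∣       : All (λ g → d ∣ w g) gs
      pos neg  : List X
      pos⊆     : All (_∈ gs) pos
      neg⊆     : All (_∈ gs) neg
      identity : d ℕ.+ weight pos ≡ weight neg

  bezout : ∀ gs → Bezout gs
  bezout []       = record { d = 0 ; d∣ = [] ; pos = [] ; neg = [] ; pos⊆ = [] ; neg⊆ = [] ; identity = refl }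
  bezout (g ∷ gs) with bezout gs
  ... | record { d = e ; d∣ = e∣ ; pos = P ; neg = N ; pos⊆ = P⊆ ; neg⊆ = N⊆ ; identity = e+P≡N }
      with Bézout.lemma (w g) e
  ... | Bézout.result d gcd (Bézout.+- x y d+ye≡xg) = record
    { d = d ; d∣ = d∣ ; pos = copies y N ; neg = replicate x g ++ copies y P
    ; pos⊆ = copies⁺ y (All.map there N⊆) ; neg⊆ = AllP.++⁺ (AllP.replicate⁺ x (here refl)) (copies⁺ y (All.map there P⊆))
    ; identity = begin
        d ℕ.+ weight (copies y N)                 ≡⟨ cong (d ℕ.+_) (trans (weight-copies y N) (cong (y ℕ.*_) (sym e+P≡N))) ⟩
        d ℕ.+ y ℕ.* (e ℕ.+ weight P)              ≡⟨ cong (d ℕ.+_) (ℕP.*-distribˡ-+ y e (weight P)) ⟩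
        d ℕ.+ (y ℕ.* e ℕ.+ y ℕ.* weight P)        ≡⟨ ℕP.+-assoc d (y ℕ.* e) _ ⟨
        (d ℕ.+ y ℕ.* e) ℕ.+ y ℕ.* weight P        ≡⟨ cong₂ ℕ._+_ d+ye≡xg (sym (weight-copies y P)) ⟩
        x ℕ.* w g ℕ.+ weight (copies y P)         ≡⟨ cong (ℕ._+ weight (copies y P)) (weight-replicate x g) ⟨
        weight (replicate x g) ℕ.+ weight (copies y P) ≡⟨ weight-++ (replicate x g) (copies y P) ⟨
        weight (replicate x g ++ copies y P)      ∎ }
    where
    open ≡-Reasoning
    d∣ = GCD.gcd∣m gcd ∷ All.map (∣-trans (GCD.gcd∣n gcd)) e∣
  ... | Bézout.result d gcd (Bézout.-+ x y d+xg≡ye) = record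
    { d = d ; d∣ = d∣ ; pos = replicate x g ++ copies y P ; neg = copies y N
    ; pos⊆ = AllP.++⁺ (AllP.replicate⁺ x (here refl)) (copies⁺ y (All.map there P⊆)) ; neg⊆ = copies⁺ y (All.map there N⊆)
    ; identity = begin
        d ℕ.+ weight (replicate x g ++ copies y P)         ≡⟨ cong (d ℕ.+_) (weight-++ (replicate x g) (copies y P)) ⟩
        d ℕ.+ (weight (replicate x g) ℕ.+ weight (copies y P)) ≡⟨ cong (d ℕ.+_) (cong₂ ℕ._+_ (weight-replicate x g) (weight-copies y P)) ⟩
        d ℕ.+ (x ℕ.* w g ℕ.+ y ℕ.* weight P)               ≡⟨ ℕP.+-assoc d (x ℕ.* w g) _ ⟨
        (d ℕ.+ x ℕ.* w g) ℕ.+ y ℕ.* weight P               ≡⟨ cong (ℕ._+ y ℕ.* weight P) d+xg≡ye ⟩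
        y ℕ.* e ℕ.+ y ℕ.* weight P                          ≡⟨ ℕP.*-distribˡ-+ y e (weight P) ⟨
        y ℕ.* (e ℕ.+ weight P)                              ≡⟨ cong (y ℕ.*_) e+P≡N ⟩
        y ℕ.* weight N                                      ≡⟨ weight-copies y N ⟨
        weight (copies y N)                                 ∎ }
    where
    open ≡-Reasoning
    d∣ = GCD.gcd∣m gcd ∷ All.map (∣-trans (GCD.gcd∣n gcd)) e∣

-- Seeds: tuples with prescribed non-minimal entries

sumℤ-↭ : ∀ {xs ys} → xs ↭ ys → sumℤ xs ≡ sumℤ ys
sumℤ-↭ ↭.refl          = refl
sumℤ-↭ (↭.prep x p)    = cong (λ s → x ℤ.+ s) (sumℤ-↭ p)
sumℤ-↭ (↭.swap x y p)  = trans (x∙yz≈y∙xz x y _) (cong (λ s → y ℤ.+ (x ℤ.+ s)) (sumℤ-↭ p))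
sumℤ-↭ (↭.trans p p′) = trans (sumℤ-↭ p) (sumℤ-↭ p′)

occurrences : ∀ {X : Set} → DecidableEquality X → X → List X → ℕ
occurrences _≟_ x xs = length (filter (x ≟_) xs)

module _ {X : Set} (_≟_ : DecidableEquality X) where

  occurrences-↭ : ∀ x {xs ys} → xs ↭ ys → occurrences _≟_ x xs ≡ occurrences _≟_ x ys
  occurrences-↭ x p = ↭-length (filter-↭ (x ≟_) p)

  occurrences-++ : ∀ x xs ys → occurrences _≟_ x (xs ++ ys) ≡ occurrences _≟_ x xs ℕ.+ occurrences _≟_ x ys
  occurrences-++ x xs ys = trans (cong length (filter-++ (x ≟_) xs ys)) (length-++ (filter (x ≟_) xs))

  occurrences-∷-≡ : ∀ x xs → occurrences _≟_ x (x ∷ xs) ≡ suc (occurrences _≟_ x xs)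
  occurrences-∷-≡ x xs = cong length (filter-accept (x ≟_) refl)

  occurrences-∷-≢ : ∀ {x y} xs → x ≢ y → occurrences _≟_ x (y ∷ xs) ≡ occurrences _≟_ x xs
  occurrences-∷-≢ {x} xs x≢y = cong length (filter-reject (x ≟_) x≢y)

  occurrences-replicate-≡ : ∀ x k → occurrences _≟_ x (replicate k x) ≡ k
  occurrences-replicate-≡ x k = trans (cong length (filter-all (x ≟_) (AllP.replicate⁺ k refl))) (length-replicate k)

  occurrences-replicate-≢ : ∀ {x y} k → x ≢ y → occurrences _≟_ x (replicate k y) ≡ 0
  occurrences-replicate-≢ {x} k x≢y = cong length (filter-none (x ≟_) (AllP.replicate⁺ k x≢y))

length-insert : ∀ a v → length (insert a v) ≡ suc (length v)
length-insert a v = ↭-length (insert-↭ a v)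

insert⁺ : ∀ {P : ℤ → Set} {a v} → P a → All P v → All P (insert a v)
insert⁺ {a = a} {v} pa pv = All-resp-↭ (↭-sym (insert-↭ a v)) (pa ∷ pv)

insert-sorted : ∀ a {v} → Sorted v → Sorted (insert a v)
insert-sorted a v↗ = Linked⇒AllPairs ℤP.≤-trans (insert-↗ a (AllPairs⇒Linked v↗))

sumℤ-insert : ∀ a v → sumℤ (insert a v) ≡ a ℤ.+ sumℤ v
sumℤ-insert a v = sumℤ-↭ (insert-↭ a v)

rowAt : ∀ {q} → Fin q → List (List ℤ) → List ℤ
rowAt i       []      = []
rowAt zero    (v ∷ T) = v
rowAt (suc i) (v ∷ T) = rowAt i T

insertAt : ∀ {q} → Fin q → ℤ → List (List ℤ) → List (List ℤ)
insertAt i       a []      = []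
insertAt zero    a (v ∷ T) = insert a v ∷ T
insertAt (suc i) a (v ∷ T) = v ∷ insertAt i a T

insertAt-chromatic : ∀ {q} {A : Vec (List ℤ) q} {h T a} (i : Fin q) → a ∈ lookup A i → Chromatic A h T →
  Chromatic A (h [ i ]%= suc) (insertAt i a T)
insertAt-chromatic zero    a∈ (_∷_ {v = v} (row refl v⊆ v↗) c) = row (length-insert _ v) (insert⁺ a∈ v⊆) (insert-sorted _ v↗) ∷ c
insertAt-chromatic (suc i) a∈ (r ∷ c)                            = r ∷ insertAt-chromatic i a∈ c

totalSum-insertAt : ∀ {q} {A : Vec (List ℤ) q} {h T} (i : Fin q) a → Chromatic A h T → totalSum (insertAt i a T) ≡ a ℤ.+ totalSum T
totalSum-insertAt zero    a (_∷_ {v = v} {T = T} _ _) =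
  trans (cong (ℤ._+ totalSum T) (sumℤ-insert a v)) (ℤP.+-assoc a (sumℤ v) (totalSum T))
totalSum-insertAt (suc i) a (_∷_ {v = v} _ c) =
  trans (cong (λ s → sumℤ v ℤ.+ s) (totalSum-insertAt i a c)) (x∙yz≈y∙xz (sumℤ v) a _)

rowAt-insertAt : ∀ {q} {A : Vec (List ℤ) q} {h T} (i : Fin q) a → Chromatic A h T → rowAt i (insertAt i a T) ≡ insert a (rowAt i T)
rowAt-insertAt zero    a (_ ∷ _) = refl
rowAt-insertAt (suc i) a (_ ∷ c) = rowAt-insertAt i a c

rowAt-insertAt-≢ : ∀ {q} {i j : Fin q} a T → i ≢ j → rowAt i (insertAt j a T) ≡ rowAt i T
rowAt-insertAt-≢ {i = i}     {j}     a []      _   = refl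
rowAt-insertAt-≢ {i = zero}  {zero}  a (v ∷ T) i≢j = ⊥-elim (i≢j refl)
rowAt-insertAt-≢ {i = zero}  {suc j} a (v ∷ T) _   = refl
rowAt-insertAt-≢ {i = suc i} {zero}  a (v ∷ T) _   = refl
rowAt-insertAt-≢ {i = suc i} {suc j} a (v ∷ T) i≢j = rowAt-insertAt-≢ a T (i≢j ∘ cong suc)

rowAt-prependMins : ∀ {q} {A : Vec (List ℤ) q} {h T} (i : Fin q) ms ks → Chromatic A h T →
  rowAt i (prependMins ms ks T) ≡ replicate (lookup ks i) (lookup ms i) ++ rowAt i T
rowAt-prependMins zero    (m ∷ ms) (k ∷ ks) (_ ∷ _) = refl
rowAt-prependMins (suc i) (m ∷ ms) (k ∷ ks) (_ ∷ c) = rowAt-prependMins i ms ks c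

empty-chromatic : ∀ {q} (A : Vec (List ℤ) q) → Chromatic A (Vec.replicate q 0) (replicate q [])
empty-chromatic []      = []
empty-chromatic (_ ∷ A) = row refl [] [] ∷ empty-chromatic A

totalSum-empty : ∀ q → totalSum (replicate q []) ≡ + 0
totalSum-empty zero    = refl
totalSum-empty (suc q) = trans (ℤP.+-identityˡ _) (totalSum-empty q)

rowAt-empty : ∀ {q} (i : Fin q) → rowAt i (replicate q []) ≡ []
rowAt-empty zero    = refl
rowAt-empty (suc i) = rowAt-empty i

module Uses {q : ℕ} (A : Vec (List ℤ) q) {ms : Vec ℤ q} (imin : Pointwise IsMin A ms) where

  Use : Set
  Use = Fin q × ℤ

  _≟ᵘ_ : DecidableEquality Use
  _≟ᵘ_ = ≡-dec Fin._≟_ ℤ._≟_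

  UseOK : Use → Set
  UseOK (i , a) = a ∈ lookup A i

  gap : Use → ℕ
  gap (i , a) = ∣ a ℤ.- lookup ms i ∣

  gapSum : List Use → ℕ
  gapSum = weight gap

  counts : List Use → Vec ℕ q
  counts []            = Vec.replicate q 0
  counts ((i , _) ∷ U) = counts U [ i ]%= suc

  place : List Use → List (List ℤ)
  place []            = replicate q []
  place ((i , a) ∷ U) = insertAt i a (place U)

  place-chromatic : ∀ {U} → All UseOK U → Chromatic A (counts U) (place U)
  place-chromatic []                         = empty-chromatic A
  place-chromatic {(i , a) ∷ U} (a∈ ∷ U✓) = insertAt-chromatic i a∈ (place-chromatic U✓)

  totalSum-place : ∀ {U} → All UseOK U → totalSum (place U) ≡ dot (counts U) ms ℤ.+ + gapSum U
  totalSum-place []                         = trans (totalSum-empty q) (sym (trans (ℤP.+-identityʳ _) (dot-zero ms)))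
  totalSum-place {(i , a) ∷ U} (a∈ ∷ U✓) = begin
    totalSum (insertAt i a (place U))                                     ≡⟨ totalSum-insertAt i a (place-chromatic U✓) ⟩
    a ℤ.+ totalSum (place U)                                              ≡⟨ cong₂ ℤ._+_ (i≤j⇒j≡i+∣j-i∣ mᵢ≤a) (totalSum-place U✓) ⟩
    (lookup ms i ℤ.+ + gap (i , a)) ℤ.+ (dot (counts U) ms ℤ.+ + gapSum U) ≡⟨ interchange (lookup ms i) (+ gap (i , a)) _ (+ gapSum U) ⟩
    (lookup ms i ℤ.+ dot (counts U) ms) ℤ.+ + gapSum ((i , a) ∷ U)       ≡⟨ cong (ℤ._+ + gapSum ((i , a) ∷ U)) (dot-updateAt-suc i (counts U) ms) ⟨
    dot (counts ((i , a) ∷ U)) ms ℤ.+ + gapSum ((i , a) ∷ U)              ∎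
    where
    open ≡-Reasoning
    mᵢ≤a : lookup ms i ℤ.≤ a
    mᵢ≤a = All.lookup (proj₂ (Pointwise.lookup imin i)) a∈

  occurrences-place : ∀ {U} → All UseOK U → ∀ i b → occurrences ℤ._≟_ b (rowAt i (place U)) ≡ occurrences _≟ᵘ_ (i , b) U
  occurrences-place []                         i b = cong (occurrences ℤ._≟_ b) (rowAt-empty i)
  occurrences-place {(j , a) ∷ U} (a∈ ∷ U✓) i b = by-colour (i Fin.≟ j)
    where
    by-colour : Dec (i ≡ j) → occurrences ℤ._≟_ b (rowAt i (place ((j , a) ∷ U))) ≡ occurrences _≟ᵘ_ (i , b) ((j , a) ∷ U)
    by-colour (no i≢j)   = trans (cong (occurrences ℤ._≟_ b) (rowAt-insertAt-≢ a (place U) i≢j))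
                             (trans (occurrences-place U✓ i b) (sym (occurrences-∷-≢ _≟ᵘ_ U (i≢j ∘ cong proj₁))))
    by-colour (yes refl) = trans (cong (occurrences ℤ._≟_ b) (rowAt-insertAt i a (place-chromatic U✓)))
                               (trans (occurrences-↭ ℤ._≟_ b (insert-↭ a _)) (by-value (b ℤ.≟ a)))
      where
      by-value : Dec (b ≡ a) → occurrences ℤ._≟_ b (a ∷ rowAt i (place U)) ≡ occurrences _≟ᵘ_ (i , b) ((i , a) ∷ U)
      by-value (yes refl) = trans (occurrences-∷-≡ ℤ._≟_ b _)
                                (trans (cong suc (occurrences-place U✓ i b)) (sym (occurrences-∷-≡ _≟ᵘ_ (i , b) U)))
      by-value (no b≢a)     = trans (occurrences-∷-≢ ℤ._≟_ _ b≢a)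
                                (trans (occurrences-place U✓ i b) (sym (occurrences-∷-≢ _≟ᵘ_ U (b≢a ∘ cong proj₂))))

  counts-bounded : ∀ U → VAll.All (_≤ length U) (counts U)
  counts-bounded []            = zeros q
    where
    zeros : ∀ n → VAll.All (_≤ 0) (Vec.replicate n 0)
    zeros zero    = VAll.[]
    zeros (suc n) = z≤n VAll.∷ zeros n
  counts-bounded ((i , _) ∷ U) = updateAt-suc-bounded i (counts-bounded U)

  counts-topped-up : ∀ {C} U → length U ≤ C → counts U +ᵛ Vec.map (C ℕ.∸_) (counts U) ≡ Vec.replicate q C
  counts-topped-up {C} U U≤C = c+ᵛ[C∸c]≡C C (VAll.map (λ k≤ → ℕP.≤-trans k≤ U≤C) (counts-bounded U))

  seed : ℕ → List Use → List (List ℤ)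
  seed C U = prependMins ms (Vec.map (C ℕ.∸_) (counts U)) (place U)

  seed-chromatic : ∀ {C U} → length U ≤ C → All UseOK U → Chromatic A (Vec.replicate q C) (seed C U)
  seed-chromatic {C} {U} U≤C U✓ = subst (λ h → Chromatic A h (seed C U)) (counts-topped-up U U≤C)
    (prependMins-chromatic (Vec.map (C ℕ.∸_) (counts U)) imin (place-chromatic U✓))

  totalSum-seed : ∀ {C U} → length U ≤ C → All UseOK U → totalSum (seed C U) ≡ dot (Vec.replicate q C) ms ℤ.+ + gapSum U
  totalSum-seed {C} {U} U≤C U✓ = begin
    totalSum (seed C U)                              ≡⟨ totalSum-prependMins (place-chromatic U✓) ms pad ⟩
    dot pad ms ℤ.+ totalSum (place U)                ≡⟨ cong (λ s → dot pad ms ℤ.+ s) (totalSum-place U✓) ⟩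
    dot pad ms ℤ.+ (dot (counts U) ms ℤ.+ + gapSum U) ≡⟨ x∙yz≈yx∙z (dot pad ms) (dot (counts U) ms) (+ gapSum U) ⟩
    (dot (counts U) ms ℤ.+ dot pad ms) ℤ.+ + gapSum U ≡⟨ cong (ℤ._+ + gapSum U) (dot-+ᵛ (counts U) pad ms) ⟨
    dot (counts U +ᵛ pad) ms ℤ.+ + gapSum U          ≡⟨ cong (λ h → dot h ms ℤ.+ + gapSum U) (counts-topped-up U U≤C) ⟩
    dot (Vec.replicate q C) ms ℤ.+ + gapSum U        ∎
    where
    open ≡-Reasoning
    pad = Vec.map (C ℕ.∸_) (counts U)

  occurrences-seed : ∀ {C U} → All UseOK U → ∀ i b → b ≢ lookup ms i →
    occurrences ℤ._≟_ b (rowAt i (seed C U)) ≡ occurrences _≟ᵘ_ (i , b) U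
  occurrences-seed {C} {U} U✓ i b b≢mᵢ = begin
    occurrences ℤ._≟_ b (rowAt i (seed C U))                                               ≡⟨ cong (occurrences ℤ._≟_ b) (rowAt-prependMins i ms pad (place-chromatic U✓)) ⟩
    occurrences ℤ._≟_ b (replicate (lookup pad i) (lookup ms i) ++ rowAt i (place U))    ≡⟨ occurrences-++ ℤ._≟_ b (replicate (lookup pad i) (lookup ms i)) _ ⟩
    occurrences ℤ._≟_ b (replicate (lookup pad i) (lookup ms i)) ℕ.+ occurrences ℤ._≟_ b (rowAt i (place U))
                                                                                            ≡⟨ cong₂ ℕ._+_ (occurrences-replicate-≢ ℤ._≟_ (lookup pad i) b≢mᵢ) (occurrences-place U✓ i b) ⟩
    occurrences _≟ᵘ_ (i , b) U                                                              ∎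
    where
    open ≡-Reasoning
    pad = Vec.map (C ℕ.∸_) (counts U)

module Witnesses {q : ℕ} (A : Vec (List ℤ) q) {ms : Vec ℤ q} (imin : Pointwise IsMin A ms) where
  open Uses A imin

  NonMin : Use → Set
  NonMin (i , a) = a ≢ lookup ms i

  0<gap : ∀ {γ} → UseOK γ → NonMin γ → 0 < gap γ
  0<gap {i , a} a∈ a≢mᵢ = i<j⇒0<∣j-i∣ (ℤP.≤∧≢⇒< (All.lookup (proj₂ (Pointwise.lookup imin i)) a∈) (a≢mᵢ ∘ sym))

  record WitnessFamily (t : ℕ) : Set where
    field
      witness    : ℕ → List Use
      witness✓   : ∀ {k} → k < t → All UseOK (witness k)
      common     : ℕ
      gapSum≡    : ∀ {k} → k < t → gapSum (witness k) ≡ common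
      size       : ℕ
      length≤    : ∀ {k} → k < t → length (witness k) ≤ size
      separated  : ∀ C {B k k′} → All UseOK B → k < t → k′ < t →
                   seed C (B ++ witness k) ≡ seed C (B ++ witness k′) → k ≡ k′

  singleton-family : WitnessFamily 1
  singleton-family = record
    { witness = λ _ → [] ; witness✓ = λ _ → [] ; common = 0 ; gapSum≡ = λ _ → refl ; size = 0
    ; length≤ = λ _ → z≤n ; separated = λ { _ _ (s≤s z≤n) (s≤s z≤n) _ → refl } }

  pair-family : ∀ t {γ₁ γ₂} → UseOK γ₁ → UseOK γ₂ → γ₁ ≢ γ₂ → NonMin γ₁ → NonMin γ₂ → WitnessFamily t
  pair-family t {γ₁} {γ₂} γ₁✓ γ₂✓ γ₁≢γ₂ γ₁-nonmin γ₂-nonmin = record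
    { witness = W ; witness✓ = λ {k} _ → W✓ k
    ; common = (t ∸ 1) ℕ.* (g₁ ℕ.* g₂) ; gapSum≡ = gapSum-W
    ; size = (t ∸ 1) ℕ.* g₂ ℕ.+ (t ∸ 1) ℕ.* g₁ ; length≤ = length-W
    ; separated = separated }
    where
    g₁ = gap γ₁
    g₂ = gap γ₂

    -- Witness k uses γ₁ k·g₂ times and γ₂ (t − 1 − k)·g₁ times, so all witnesses have gap sum
    -- (t − 1)·g₁·g₂, while the number of copies of γ₁ recovers k.
    W : ℕ → List Use
    W k = replicate (k ℕ.* g₂) γ₁ ++ replicate ((t ∸ 1 ∸ k) ℕ.* g₁) γ₂

    W✓ : ∀ k → All UseOK (W k)
    W✓ k = AllP.++⁺ (AllP.replicate⁺ (k ℕ.* g₂) γ₁✓) (AllP.replicate⁺ ((t ∸ 1 ∸ k) ℕ.* g₁) γ₂✓)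

    k≤t-1 : ∀ {k} → k < t → k ≤ t ∸ 1
    k≤t-1 (s≤s k≤) = k≤

    gapSum-W : ∀ {k} → k < t → gapSum (W k) ≡ (t ∸ 1) ℕ.* (g₁ ℕ.* g₂)
    gapSum-W {k} k<t = begin
      gapSum (W k)
        ≡⟨ weight-++ gap (replicate (k ℕ.* g₂) γ₁) _ ⟩
      gapSum (replicate (k ℕ.* g₂) γ₁) ℕ.+ gapSum (replicate (l ℕ.* g₁) γ₂)
        ≡⟨ cong₂ ℕ._+_ (weight-replicate gap (k ℕ.* g₂) γ₁) (weight-replicate gap (l ℕ.* g₁) γ₂) ⟩
      k ℕ.* g₂ ℕ.* g₁ ℕ.+ l ℕ.* g₁ ℕ.* g₂                           ≡⟨ collect k l g₁ g₂ ⟩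
      (k ℕ.+ l) ℕ.* (g₁ ℕ.* g₂)                                     ≡⟨ cong (ℕ._* (g₁ ℕ.* g₂)) (ℕP.m+[n∸m]≡n (k≤t-1 k<t)) ⟩
      (t ∸ 1) ℕ.* (g₁ ℕ.* g₂)                                       ∎
      where
      open ≡-Reasoning
      l = t ∸ 1 ∸ k
      collect : ∀ k l g₁ g₂ → k ℕ.* g₂ ℕ.* g₁ ℕ.+ l ℕ.* g₁ ℕ.* g₂ ≡ (k ℕ.+ l) ℕ.* (g₁ ℕ.* g₂)
      collect = ℕ-Solver.solve-∀

    length-W : ∀ {k} → k < t → length (W k) ≤ (t ∸ 1) ℕ.* g₂ ℕ.+ (t ∸ 1) ℕ.* g₁
    length-W {k} k<t = subst (_≤ _) (sym (trans (length-++ (replicate (k ℕ.* g₂) γ₁)) (cong₂ ℕ._+_ (length-replicate (k ℕ.* g₂)) (length-replicate ((t ∸ 1 ∸ k) ℕ.* g₁)))))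
      (ℕP.+-mono-≤ (ℕP.*-monoˡ-≤ g₂ (k≤t-1 k<t)) (ℕP.*-monoˡ-≤ g₁ (ℕP.m∸n≤m (t ∸ 1) k)))

    occurrences-γ₁ : ∀ B k → occurrences _≟ᵘ_ γ₁ (B ++ W k) ≡ occurrences _≟ᵘ_ γ₁ B ℕ.+ k ℕ.* g₂
    occurrences-γ₁ B k = begin
      occurrences _≟ᵘ_ γ₁ (B ++ W k)                         ≡⟨ occurrences-++ _≟ᵘ_ γ₁ B (W k) ⟩
      occurrences _≟ᵘ_ γ₁ B ℕ.+ occurrences _≟ᵘ_ γ₁ (W k)    ≡⟨ cong (occurrences _≟ᵘ_ γ₁ B ℕ.+_) (occurrences-++ _≟ᵘ_ γ₁ (replicate (k ℕ.* g₂) γ₁) _) ⟩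
      occurrences _≟ᵘ_ γ₁ B ℕ.+ (occurrences _≟ᵘ_ γ₁ (replicate (k ℕ.* g₂) γ₁) ℕ.+ occurrences _≟ᵘ_ γ₁ (replicate ((t ∸ 1 ∸ k) ℕ.* g₁) γ₂))
        ≡⟨ cong (occurrences _≟ᵘ_ γ₁ B ℕ.+_) (cong₂ ℕ._+_ (occurrences-replicate-≡ _≟ᵘ_ γ₁ (k ℕ.* g₂)) (occurrences-replicate-≢ _≟ᵘ_ ((t ∸ 1 ∸ k) ℕ.* g₁) γ₁≢γ₂)) ⟩
      occurrences _≟ᵘ_ γ₁ B ℕ.+ (k ℕ.* g₂ ℕ.+ 0)            ≡⟨ cong (occurrences _≟ᵘ_ γ₁ B ℕ.+_) (ℕP.+-identityʳ (k ℕ.* g₂)) ⟩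
      occurrences _≟ᵘ_ γ₁ B ℕ.+ k ℕ.* g₂                    ∎
      where open ≡-Reasoning

    separated : ∀ C {B k k′} → All UseOK B → k < t → k′ < t → seed C (B ++ W k) ≡ seed C (B ++ W k′) → k ≡ k′
    separated C {B} {k} {k′} B✓ _ _ seeds≡ = ℕP.*-cancelʳ-≡ k k′ g₂ {{ℕ.>-nonZero (0<gap γ₂✓ γ₂-nonmin)}}
      (ℕP.+-cancelˡ-≡ (occurrences _≟ᵘ_ γ₁ B) _ _ (begin
        occurrences _≟ᵘ_ γ₁ B ℕ.+ k ℕ.* g₂                       ≡⟨ occurrences-γ₁ B k ⟨
        occurrences _≟ᵘ_ γ₁ (B ++ W k)                           ≡⟨ occurrences-seed (AllP.++⁺ B✓ (W✓ k)) i₁ a₁ γ₁-nonmin ⟨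
        occurrences ℤ._≟_ a₁ (rowAt i₁ (seed C (B ++ W k)))      ≡⟨ cong (occurrences ℤ._≟_ a₁ ∘′ rowAt i₁) seeds≡ ⟩
        occurrences ℤ._≟_ a₁ (rowAt i₁ (seed C (B ++ W k′)))     ≡⟨ occurrences-seed (AllP.++⁺ B✓ (W✓ k′)) i₁ a₁ γ₁-nonmin ⟩
        occurrences _≟ᵘ_ γ₁ (B ++ W k′)                          ≡⟨ occurrences-γ₁ B k′ ⟩
        occurrences _≟ᵘ_ γ₁ B ℕ.+ k′ ℕ.* g₂                      ∎))
      where
      open ≡-Reasoning
      i₁ = proj₁ γ₁
      a₁ = proj₂ γ₁

module Seeding {q : ℕ} (A : Vec (List ℤ) q) {ms : Vec ℤ q} (imin : Pointwise IsMin A ms) where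
  open Uses A imin
  open Witnesses A imin

  uses : List Use
  uses = concatMap (λ i → map (i ,_) (lookup A i)) (allFin q)

  ∈-uses⁺ : ∀ {γ} → UseOK γ → γ ∈ uses
  ∈-uses⁺ {i , a} a∈ = ∈-concatMap⁺ (λ i → map (i ,_) (lookup A i)) (lose (∈-allFin i) (∈-map⁺ (i ,_) a∈))

  ∈-uses⁻ : ∀ {γ} → γ ∈ uses → UseOK γ
  ∈-uses⁻ γ∈ with i , _ , γ∈ᵢ ← find (∈-concatMap⁻ (λ i → map (i ,_) (lookup A i)) {xs = allFin q} γ∈)
             with a , a∈ , refl ← ∈-map⁻ (i ,_) γ∈ᵢ = a∈

  module Divisibility (bezout : Bezout gap uses) where
    open Bezout bezout renaming (d to D)

    D∣gap : ∀ {γ} → UseOK γ → D ∣ gap γ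
    D∣gap γ✓ = All.lookup d∣ (∈-uses⁺ γ✓)

    D∣gapSum : ∀ {U} → All UseOK U → D ∣ gapSum U
    D∣gapSum []          = divides 0 refl
    D∣gapSum (γ✓ ∷ U✓) = ∣m∣n⇒∣m+n (D∣gap γ✓) (D∣gapSum U✓)

  module Seeds {t : ℕ} (1≤t : 1 ≤ t) (family : WitnessFamily t) (bezout : Bezout gap uses) (L : ℕ) where
    open WitnessFamily family
    open Bezout bezout renaming (d to D)
    open Divisibility bezout

    D∣pos : D ∣ gapSum pos
    D∣pos = D∣gapSum (All.map ∈-uses⁻ pos⊆)

    D∣common : D ∣ common
    D∣common = subst (D ∣_) (gapSum≡ 1≤t) (D∣gapSum (witness✓ 1≤t))

    κ : ℕ
    κ = L ℕ.* quotient D∣pos ℕ.+ quotient D∣common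

    C : ℕ
    C = L ℕ.* (length pos ℕ.+ length neg) ℕ.+ size

    h₀ : Vec ℕ q
    h₀ = Vec.replicate q C

    -- Since D + gapSum pos ≡ gapSum neg, the gap sum L·gapSum pos + D·jj of a combination
    -- climbs through consecutive multiples of D as jj runs from 0 to L.
    combination : ℕ → List Use
    combination jj = copies gap (L ∸ jj) pos ++ copies gap jj neg

    combination✓ : ∀ jj → All UseOK (combination jj)
    combination✓ jj = AllP.++⁺ (copies⁺ gap (L ∸ jj) (All.map ∈-uses⁻ pos⊆)) (copies⁺ gap jj (All.map ∈-uses⁻ neg⊆))

    gapSum-seed-uses : ∀ {jj k} → jj ≤ L → k < t → gapSum (combination jj ++ witness k) ≡ D ℕ.* (κ ℕ.+ jj)
    gapSum-seed-uses {jj} {k} jj≤L k<t = begin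
      gapSum (combination jj ++ witness k)                                          ≡⟨ weight-++ gap (combination jj) (witness k) ⟩
      gapSum (combination jj) ℕ.+ gapSum (witness k)                                ≡⟨ cong₂ ℕ._+_ (weight-++ gap (copies gap (L ∸ jj) pos) _) (gapSum≡ k<t) ⟩
      (gapSum (copies gap (L ∸ jj) pos) ℕ.+ gapSum (copies gap jj neg)) ℕ.+ common  ≡⟨ cong (ℕ._+ common) (cong₂ ℕ._+_ (weight-copies gap (L ∸ jj) pos) (weight-copies gap jj neg)) ⟩
      ((L ∸ jj) ℕ.* gapSum pos ℕ.+ jj ℕ.* gapSum neg) ℕ.+ common                    ≡⟨ cong (λ n → ((L ∸ jj) ℕ.* gapSum pos ℕ.+ jj ℕ.* n) ℕ.+ common) identity ⟨
      ((L ∸ jj) ℕ.* gapSum pos ℕ.+ jj ℕ.* (D ℕ.+ gapSum pos)) ℕ.+ common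
        ≡⟨ cong₂ (λ P c → ((L ∸ jj) ℕ.* P ℕ.+ jj ℕ.* (D ℕ.+ P)) ℕ.+ c) (_∣_.equality D∣pos) (_∣_.equality D∣common) ⟩
      ((L ∸ jj) ℕ.* (p ℕ.* D) ℕ.+ jj ℕ.* (D ℕ.+ p ℕ.* D)) ℕ.+ w ℕ.* D              ≡⟨ collect (L ∸ jj) jj p D w ⟩
      D ℕ.* ((L ∸ jj ℕ.+ jj) ℕ.* p ℕ.+ w ℕ.+ jj)                                    ≡⟨ cong (λ l → D ℕ.* (l ℕ.* p ℕ.+ w ℕ.+ jj)) (ℕP.m∸n+n≡m jj≤L) ⟩
      D ℕ.* (κ ℕ.+ jj)                                                              ∎
      where
      open ≡-Reasoning
      p = quotient D∣pos
      w = quotient D∣common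
      collect : ∀ r jj p D w → (r ℕ.* (p ℕ.* D) ℕ.+ jj ℕ.* (D ℕ.+ p ℕ.* D)) ℕ.+ w ℕ.* D ≡
                               D ℕ.* ((r ℕ.+ jj) ℕ.* p ℕ.+ w ℕ.+ jj)
      collect = ℕ-Solver.solve-∀

    length-seed-uses : ∀ {jj k} → jj ≤ L → k < t → length (combination jj ++ witness k) ≤ C
    length-seed-uses {jj} {k} jj≤L k<t = begin
      length (combination jj ++ witness k)                                         ≡⟨ length-++ (combination jj) ⟩
      length (combination jj) ℕ.+ length (witness k)                               ≡⟨ cong (ℕ._+ length (witness k)) (length-++ (copies gap (L ∸ jj) pos)) ⟩
      (length (copies gap (L ∸ jj) pos) ℕ.+ length (copies gap jj neg)) ℕ.+ length (witness k)
                                                                                   ≡⟨ cong (ℕ._+ length (witness k)) (cong₂ ℕ._+_ (length-copies gap (L ∸ jj) pos) (length-copies gap jj neg)) ⟩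
      ((L ∸ jj) ℕ.* length pos ℕ.+ jj ℕ.* length neg) ℕ.+ length (witness k)       ≤⟨ ℕP.+-mono-≤ (ℕP.+-mono-≤ (ℕP.*-monoˡ-≤ (length pos) (ℕP.m∸n≤m L jj)) (ℕP.*-monoˡ-≤ (length neg) jj≤L)) (length≤ k<t) ⟩
      (L ℕ.* length pos ℕ.+ L ℕ.* length neg) ℕ.+ size                            ≡⟨ cong (ℕ._+ size) (ℕP.*-distribˡ-+ L (length pos) (length neg)) ⟨
      C                                                                            ∎
      where open ℕP.≤-Reasoning

    seed-reps : ∀ {jj} → jj ≤ L → Reps t A h₀ (dot h₀ ms ℤ.+ + (D ℕ.* (κ ℕ.+ jj)))
    seed-reps {jj} jj≤L = reps (map tuple (upTo t))
      (unique-map⁺-local tuple below-t (separated C (combination✓ jj)) (UniqueP.upTo⁺ t))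
      (ℕP.≤-reflexive (sym (trans (length-map tuple (upTo t)) (length-upTo t))))
      (AllP.map⁺ (All.map valid below-t))
      where
      tuple : ℕ → List (List ℤ)
      tuple k = seed C (combination jj ++ witness k)
      below-t : All (_< t) (upTo t)
      below-t = All.tabulate ∈-upTo⁻
      valid : ∀ {k} → k < t → IsRep A h₀ (dot h₀ ms ℤ.+ + (D ℕ.* (κ ℕ.+ jj))) (tuple k)
      valid k<t = seed-chromatic (length-seed-uses jj≤L k<t) (AllP.++⁺ (combination✓ jj) (witness✓ k<t)) ,
                  trans (totalSum-seed (length-seed-uses jj≤L k<t) (AllP.++⁺ (combination✓ jj) (witness✓ k<t)))
                          (cong (λ g → dot h₀ ms ℤ.+ + g) (gapSum-seed-uses jj≤L k<t))

-- At most one non-minimal entry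

rigid-row : ∀ {A m k v} → (∀ {a} → a ∈ A → a ≡ m) → Row A k v → v ≡ replicate k m
rigid-row rigid (row refl v⊆ _) = all≡⇒≡replicate (All.map rigid v⊆)

rigid-tuple : ∀ {q} {A : Vec (List ℤ) q} {ms : Vec ℤ q} {h T T′} → (∀ i {a} → a ∈ lookup A i → a ≡ lookup ms i) →
  Chromatic A h T → Chromatic A h T′ → T ≡ T′
rigid-tuple {ms = []}    _     []      []        = refl
rigid-tuple {ms = _ ∷ ms} rigid (r ∷ c) (r′ ∷ c′) =
  cong₂ _∷_ (trans (rigid-row (rigid zero) r) (sym (rigid-row (rigid zero) r′))) (rigid-tuple {ms = ms} (rigid ∘ suc) c c′)

module _ {A : List ℤ} {m a₀ : ℤ} (two-valued : ∀ {a} → a ∈ A → a ≡ m ⊎ a ≡ a₀) (m<a₀ : m ℤ.< a₀) where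

  ≤a₀ : ∀ {a} → a ∈ A → a ℤ.≤ a₀
  ≤a₀ a∈ with two-valued a∈
  ... | inj₁ refl = ℤP.<⇒≤ m<a₀
  ... | inj₂ refl = ℤP.≤-refl

  min-head-lighter : ∀ {w w′} → length w ≡ length w′ → All (_∈ A) w → All (a₀ ℤ.≤_) w′ → m ℤ.+ sumℤ w ≢ a₀ ℤ.+ sumℤ w′
  min-head-lighter {w} {w′} len w⊆ a₀≤w′ sums≡ = ℤP.<-irrefl sums≡ (begin-strict
    m ℤ.+ sumℤ w                   ≤⟨ ℤP.+-monoʳ-≤ m (sum≤length*max w (All.map ≤a₀ w⊆)) ⟩
    m ℤ.+ + length w ℤ.* a₀        <⟨ ℤP.+-monoˡ-< (+ length w ℤ.* a₀) m<a₀ ⟩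
    a₀ ℤ.+ + length w ℤ.* a₀       ≡⟨ cong (λ n → a₀ ℤ.+ + n ℤ.* a₀) len ⟩
    a₀ ℤ.+ + length w′ ℤ.* a₀      ≤⟨ ℤP.+-monoʳ-≤ a₀ (length*min≤sum w′ a₀≤w′) ⟩
    a₀ ℤ.+ sumℤ w′                 ∎)
    where open ℤP.≤-Reasoning

  two-valued-row : ∀ {k v v′} → Row A k v → Row A k v′ → sumℤ v ≡ sumℤ v′ → v ≡ v′
  two-valued-row {v = []}    {[]}      _                  _              _ = refl
  two-valued-row {v = []}    {_ ∷ _}   (row refl _ _) (row () _ _) _
  two-valued-row {v = x ∷ w} {x′ ∷ w′} (row refl (x∈ ∷ w⊆) (x≤w ∷ w↗)) (row len′ (x′∈ ∷ w′⊆) (x′≤w′ ∷ w′↗)) sums≡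
    with x ℤ.≟ x′ | two-valued x∈ | two-valued x′∈
  ... | yes refl | _ | _ = cong (x ∷_) (two-valued-row (row refl w⊆ w↗) (row (ℕP.suc-injective len′) w′⊆ w′↗)
                                                         (∙-cancelˡ x _ _ sums≡))
  ... | no x≢x′ | inj₁ refl | inj₁ refl = ⊥-elim (x≢x′ refl)
  ... | no x≢x′ | inj₂ refl | inj₂ refl = ⊥-elim (x≢x′ refl)
  ... | no _    | inj₁ refl | inj₂ refl = ⊥-elim (min-head-lighter (ℕP.suc-injective (sym len′)) w⊆ x′≤w′ sums≡)
  ... | no _    | inj₂ refl | inj₁ refl = ⊥-elim (min-head-lighter (ℕP.suc-injective len′) w′⊆ x≤w (sym sums≡))

AtMostOneNonMin : ∀ {q} → Vec (List ℤ) q → Vec ℤ q → Set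
AtMostOneNonMin {q} A ms = ∀ {i j : Fin q} {a b} → a ∈ lookup A i → b ∈ lookup A j →
  a ≢ lookup ms i → b ≢ lookup ms j → (i , a) ≡ (j , b)

-- Either the first colour is constant, or it holds the only non-minimal value and every later
-- colour is constant; either way the sum pins down each row.
unique-by-sum : ∀ {q} {A : Vec (List ℤ) q} {ms h T T′} → AtMostOneNonMin A ms → Pointwise IsMin A ms →
  Chromatic A h T → Chromatic A h T′ → totalSum T ≡ totalSum T′ → T ≡ T′
unique-by-sum one []            []                        []         _     = refl
unique-by-sum {A = A ∷ As} {m ∷ ms} one (least ∷ imin) (_∷_ {v = v} {T = T} r c) (_∷_ {v = v′} {T = T′} r′ c′) sums≡
  with All.all? (ℤ._≟ m) A
... | yes A≡m = cong₂ _∷_ v≡v′ (unique-by-sum (λ a∈ b∈ a≢ b≢ → shift (one a∈ b∈ a≢ b≢)) imin c c′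
                                  (∙-cancelˡ (sumℤ v) _ _ (trans sums≡ (cong (λ u → sumℤ u ℤ.+ totalSum T′) (sym v≡v′)))))
  where
  v≡v′ = trans (rigid-row (All.lookup A≡m) r) (sym (rigid-row (All.lookup A≡m) r′))
  shift : ∀ {q} {i j : Fin q} {a b : ℤ} → (Fin.suc i , a) ≡ (suc j , b) → (i , a) ≡ (j , b)
  shift refl = refl
... | no ¬A≡m with a₀ , a₀∈ , a₀≢m ← find (AllP.¬All⇒Any¬ (ℤ._≟ m) A ¬A≡m) =
  cong₂ _∷_ (two-valued-row two-valued m<a₀ r r′ (∙-cancelʳ (totalSum T) _ _ (trans sums≡ (cong (λ U → sumℤ v′ ℤ.+ totalSum U) (sym T≡T′)))))
            T≡T′
  where
  T≡T′ : T ≡ T′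
  T≡T′ = rigid-tuple {ms = ms} rest-rigid c c′
    where
    rest-rigid : ∀ i {b} → b ∈ lookup As i → b ≡ lookup ms i
    rest-rigid i {b} b∈ with b ℤ.≟ lookup ms i
    ... | yes b≡mᵢ = b≡mᵢ
    ... | no b≢mᵢ with () ← one {i = suc i} {zero} b∈ a₀∈ b≢mᵢ a₀≢m
  two-valued : ∀ {a} → a ∈ A → a ≡ m ⊎ a ≡ a₀
  two-valued {a} a∈ with a ℤ.≟ m
  ... | yes a≡m = inj₁ a≡m
  ... | no a≢m  = inj₂ (cong proj₂ (one {i = zero} {zero} a∈ a₀∈ a≢m a₀≢m))
  m<a₀ : m ℤ.< a₀
  m<a₀ = ℤP.≤∧≢⇒< (All.lookup (proj₂ least) a₀∈) (a₀≢m ∘ sym)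

-- Covering (rh·A)^(t) by r + 2 translates of (h·A)^(t)

divide-window : ∀ {u r σ} → u < r ℕ.* σ → ∃[ j ] ∃[ jj ] j < r × jj < σ × u ≡ j ℕ.* σ ℕ.+ jj
divide-window {u} {r} {zero}  u<r*0 = ⊥-elim (ℕP.n≮0 (subst (u <_) (ℕP.*-zeroʳ r) u<r*0))
divide-window {u} {r} {suc σ} u<rσ  = u / suc σ , u % suc σ , m<n*o⇒m/o<n u<rσ , m%n<n u (suc σ) ,
  trans (m≡m%n+[m/n]*n u (suc σ)) (ℕP.+-comm (u % suc σ) _)

module Covering {q : ℕ} (A : Vec (List ℤ) q) (uA : VAll.All Unique A) {ms Ms : Vec ℤ q}
                (imin : Pointwise IsMin A ms) (imax : Pointwise IsMax A Ms) (r′ : ℕ) where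
  open Uses A imin
  open Witnesses A imin
  open Seeding A imin

  r : ℕ
  r = suc r′

  Cover : ℕ → Set
  Cover t = Σ (Vec ℕ q) λ hrt → (h : Vec ℕ q) → Pointwise _≤_ hrt h →
    Σ (List ℤ) λ X → (length X ≤ r ℕ.+ 2) ×
      ((n : ℤ) → InRestricted t A (scale r h) n → ∃[ x ] ∃[ s ] (x ∈ X × InRestricted t A h s × n ≡ x ℤ.+ s))

  cover-rigid : ∀ {t} → 2 ≤ t → AtMostOneNonMin A ms → Cover t
  cover-rigid {t} 2≤t one = Vec.replicate q 0 , λ h _ → [] , z≤n , λ n inR → ⊥-elim (no-pair (InRestricted⇒Reps uA inR))
    where
    no-pair : ∀ {h n} → Reps t A h n → ⊥
    no-pair R with _ , _ , T≢T′ , (c , sum≡) , (c′ , sum≡′) ← Reps⇒distinct-pair 2≤t R =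
      T≢T′ (unique-by-sum one imin c c′ (trans sum≡ (sym sum≡′)))

  DistinctNonMins : Set
  DistinctNonMins = Σ Use λ γ₁ → Σ Use λ γ₂ → UseOK γ₁ × UseOK γ₂ × γ₁ ≢ γ₂ × NonMin γ₁ × NonMin γ₂

  distinct-nonmins? : DistinctNonMins ⊎ AtMostOneNonMin A ms
  distinct-nonmins? with any? (λ γ₁ → any? (λ γ₂ → ¬? (γ₁ ≟ᵘ γ₂) ×-dec nonmin? γ₁ ×-dec nonmin? γ₂) uses) uses
    where
    nonmin? : ∀ γ → Dec (NonMin γ)
    nonmin? (i , a) = ¬? (a ℤ.≟ lookup ms i)
  ... | yes found with γ₁ , γ₁∈ , found₂ ← find found with γ₂ , γ₂∈ , (γ₁≢γ₂ , γ₁-nonmin , γ₂-nonmin) ← find found₂ =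
    inj₁ (γ₁ , γ₂ , ∈-uses⁻ γ₁∈ , ∈-uses⁻ γ₂∈ , γ₁≢γ₂ , γ₁-nonmin , γ₂-nonmin)
  ... | no none = inj₂ one
    where
    one : AtMostOneNonMin A ms
    one {i} {j} {a} {b} a∈ b∈ a-nonmin b-nonmin with (i , a) ≟ᵘ (j , b)
    ... | yes same = same
    ... | no differ = ⊥-elim (none (lose (∈-uses⁺ a∈) (lose (∈-uses⁺ b∈) (differ , a-nonmin , b-nonmin))))

  module _ {t : ℕ} (1≤t : 1 ≤ t) (family : WitnessFamily t) (bz : Bezout gap uses) where
    open Bezout bz using () renaming (d to D)
    open Divisibility bz

    max✓ : ∀ i → UseOK (i , lookup Ms i)
    max✓ i = proj₁ (Pointwise.lookup imax i)

    δ : Vec ℕ q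
    δ = Vec.tabulate λ i → quotient (D∣gap (max✓ i))

    shift : ∀ i → lookup Ms i ≡ lookup ms i ℤ.+ + (D ℕ.* lookup δ i)
    shift i = trans (i≤j⇒j≡i+∣j-i∣ (All.lookup (proj₂ (Pointwise.lookup imin i)) (max✓ i)))
                      (cong (λ g → lookup ms i ℤ.+ + g) (trans (_∣_.equality (D∣gap (max✓ i)))
                        (trans (ℕP.*-comm _ D) (cong (D ℕ.*_) (sym (lookup∘tabulate _ i))))))

    open Saturation imin imax D δ shift t
    open Seeds 1≤t family bz L

    -- Truncated: κ + L ≤ ε h₀ is only known when D ≠ 0 (κ+L≤ε), the only case in which κ′ matters.
    κ′ : ℕ
    κ′ = ε h₀ ∸ (κ ℕ.+ L)

    -- C gives h₀ ≤ h; D·κ puts any small excess below the window; D·r·(κ + κ′) makes a large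
    -- deficit leave the excess inside r consecutive windows.
    Cb : ℕ
    Cb = C ℕ.+ D ℕ.* κ ℕ.+ D ℕ.* (r ℕ.* (κ ℕ.+ κ′))

    module _ {{_ : NonZero D}} where

      κ+L≤ε : κ ℕ.+ L ≤ ε h₀
      κ+L≤ε = ℕP.*-cancelˡ-≤ D (begin
        D ℕ.* (κ ℕ.+ L)                        ≡⟨ excessᵀ-determined imin c sum≡ ⟨
        excessᵀ ms T₀                          ≤⟨ ℕP.m≤m+n (excessᵀ ms T₀) (deficitᵀ Ms T₀) ⟩
        excessᵀ ms T₀ ℕ.+ deficitᵀ Ms T₀       ≡⟨ excess+deficit≡ c ⟩
        D ℕ.* ε h₀                             ∎)
        where
        open ℕP.≤-Reasoning
        some-seed : ∃[ T ] IsRep A h₀ (dot h₀ ms ℤ.+ + (D ℕ.* (κ ℕ.+ L))) T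
        some-seed = Reps⇒IsRep 1≤t (seed-reps ℕP.≤-refl)
        T₀ = proj₁ some-seed
        c = proj₁ (proj₂ some-seed)
        sum≡ = proj₂ (proj₂ some-seed)

      κ+L+κ′≡ε : κ ℕ.+ L ℕ.+ κ′ ≡ ε h₀
      κ+L+κ′≡ε = ℕP.m+[n∸m]≡n κ+L≤ε

      saturated₀ : Saturated κ κ′ h₀
      saturated₀ j fits =
        seed-reps (ℕP.+-cancelˡ-≤ κ j L (ℕP.+-cancelʳ-≤ κ′ (κ ℕ.+ j) (κ ℕ.+ L) (ℕP.≤-trans fits (ℕP.≤-reflexive (sym κ+L+κ′≡ε)))))

      saturated : ∀ {h} → Pointwise _≤_ h₀ h → Saturated κ κ′ h
      saturated h₀≤h = saturated-climb (ℕP.≤-reflexive κ+L+κ′≡ε) saturated₀ (climb-from-≤ h₀≤h)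

    module Profile (h : Vec ℕ q) (Cb≤h : Pointwise _≤_ (Vec.replicate q Cb) h) where
      ks : Vec ℕ q
      ks = scale r′ h

      xlow xhigh : ℤ
      xlow  = dot ks ms
      xhigh = dot ks Ms

      σ : ℕ
      σ = ε h ∸ (κ ℕ.+ κ′)

      xmid : ℕ → ℤ
      xmid j = xlow ℤ.+ + (D ℕ.* (j ℕ.* σ))

      X : List ℤ
      X = xlow ∷ xhigh ∷ map xmid (upTo r)

      length-X : length X ≤ r ℕ.+ 2
      length-X = ℕP.≤-reflexive (trans (cong (2 ℕ.+_) (trans (length-map xmid (upTo r)) (length-upTo r))) (ℕP.+-comm 2 r))

      Cb≤hᵢ : VAll.All (Cb ≤_) h
      Cb≤hᵢ = bound Cb≤h
        where
        bound : ∀ {n} {h : Vec ℕ n} → Pointwise _≤_ (Vec.replicate n Cb) h → VAll.All (Cb ≤_) h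
        bound []          = VAll.[]
        bound (≤a ∷ ≤h) = ≤a VAll.∷ bound ≤h

      h₀≤h : Pointwise _≤_ h₀ h
      h₀≤h = lower Cb≤h
        where
        lower : ∀ {n} {h : Vec ℕ n} → Pointwise _≤_ (Vec.replicate n Cb) h → Pointwise _≤_ (Vec.replicate n C) h
        lower []          = []
        lower (≤a ∷ ≤h) = ℕP.≤-trans (ℕP.≤-trans (ℕP.m≤m+n C (D ℕ.* κ)) (ℕP.m≤m+n _ _)) ≤a ∷ lower ≤h

      Covered : ℤ → Set
      Covered n = ∃[ x ] ∃[ s ] (x ∈ X × InRestricted t A h s × n ≡ x ℤ.+ s)

      low-end : ∀ {n T} → IsRep A (scale r h) n T → excessᵀ ms T ≤ Cb → Reps t A (scale r h) n → Covered n
      low-end {n} {T} (c , sum≡) e≤Cb R =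
        xlow , s , here refl ,
        Reps⇒InRestricted (Reps-dropMins ks imin Cb≤hᵢ e≤Cb (subst (Reps t A (h +ᵛ ks)) n≡ (subst (λ h′ → Reps t A h′ n) (scale-suc r′ h) R))) ,
        n≡
        where
        e = excessᵀ ms T
        s = dot h ms ℤ.+ + e
        n≡ : n ≡ xlow ℤ.+ s
        n≡ = begin
          n                                   ≡⟨ sum≡ ⟨
          totalSum T                          ≡⟨ totalSum≡dot+excess imin c ⟩
          dot (scale r h) ms ℤ.+ + e          ≡⟨ cong (λ h′ → dot h′ ms ℤ.+ + e) (scale-suc r′ h) ⟩
          dot (h +ᵛ ks) ms ℤ.+ + e            ≡⟨ cong (ℤ._+ + e) (dot-+ᵛ h ks ms) ⟩
          (dot h ms ℤ.+ xlow) ℤ.+ + e         ≡⟨ xy∙z≈y∙xz (dot h ms) xlow (+ e) ⟩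
          xlow ℤ.+ s                          ∎
          where open ≡-Reasoning

      high-end : ∀ {n T} → IsRep A (scale r h) n T → deficitᵀ Ms T ≤ Cb → Reps t A (scale r h) n → Covered n
      high-end {n} {T} (c , sum≡) d≤Cb R =
        xhigh , s , there (here refl) ,
        Reps⇒InRestricted (Reps-takeMaxs ks imax Cb≤hᵢ d≤Cb s+d≡ (subst (Reps t A (h +ᵛ ks)) n≡ (subst (λ h′ → Reps t A h′ n) (scale-suc r′ h) R))) ,
        n≡
        where
        d = deficitᵀ Ms T
        s = n ℤ.- xhigh
        n≡ : n ≡ xhigh ℤ.+ s
        n≡ = sym (trans (ℤP.+-comm xhigh s) (//-rightDividesˡ xhigh n))
        s+d≡ : s ℤ.+ + d ≡ dot h Ms
        s+d≡ = begin
          (n ℤ.- xhigh) ℤ.+ + d               ≡⟨ xy∙z≈xz∙y n (ℤ.- xhigh) (+ d) ⟩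
          (n ℤ.+ + d) ℤ.- xhigh               ≡⟨ cong (ℤ._- xhigh) (cong (ℤ._+ + d) sum≡) ⟨
          (totalSum T ℤ.+ + d) ℤ.- xhigh      ≡⟨ cong (ℤ._- xhigh) (totalSum+deficit≡dot imax c) ⟩
          dot (scale r h) Ms ℤ.- xhigh        ≡⟨ cong (λ h′ → dot h′ Ms ℤ.- xhigh) (scale-suc r′ h) ⟩
          dot (h +ᵛ ks) Ms ℤ.- xhigh          ≡⟨ cong (ℤ._- xhigh) (dot-+ᵛ h ks Ms) ⟩
          (dot h Ms ℤ.+ xhigh) ℤ.- xhigh      ≡⟨ //-rightDividesʳ xhigh (dot h Ms) ⟩
          dot h Ms                            ∎
          where open ≡-Reasoning

      module Middle {n : ℤ} {T : List (List ℤ)} (T-rep : IsRep A (scale r h) n T)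
                    (Cb<e : Cb < excessᵀ ms T) (Cb<d : Cb < deficitᵀ Ms T) where
        c    = proj₁ T-rep
        sum≡ = proj₂ T-rep
        e    = excessᵀ ms T
        d    = deficitᵀ Ms T

        D∣e : D ∣ e
        D∣e = excessᵀ-divisible {ms = ms} (λ _ a∈ → D∣gap a∈) c

        k : ℕ
        k = quotient D∣e

        e≡Dk : e ≡ D ℕ.* k
        e≡Dk = trans (_∣_.equality D∣e) (ℕP.*-comm k D)

        instance
          D≢0 : NonZero D
          D≢0 = ℕ.≢-nonZero λ D≡0 → ℕP.n≮0 (subst (Cb <_) (trans e≡Dk (cong (ℕ._* k) D≡0)) Cb<e)

        ε≡ : ε h ≡ κ ℕ.+ κ′ ℕ.+ σ
        ε≡ = sym (ℕP.m+[n∸m]≡n (ℕP.≤-trans (ℕP.+-monoˡ-≤ κ′ (ℕP.m≤m+n κ L))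
                                 (ℕP.≤-trans (ℕP.≤-reflexive κ+L+κ′≡ε) (climb-ε (climb-from-≤ h₀≤h)))))

        κ<k : κ < k
        κ<k = ℕP.*-cancelˡ-< D κ k (ℕP.≤-<-trans (ℕP.≤-trans (ℕP.m≤n+m (D ℕ.* κ) C) (ℕP.m≤m+n _ _)) (subst (Cb <_) e≡Dk Cb<e))

        k<rσ : k < r ℕ.* σ
        k<rσ = ℕP.*-cancelˡ-< D k (r ℕ.* σ) (ℕP.+-cancelˡ-< (D ℕ.* (r ℕ.* (κ ℕ.+ κ′))) (D ℕ.* k) (D ℕ.* (r ℕ.* σ)) (begin-strict
          D ℕ.* (r ℕ.* (κ ℕ.+ κ′)) ℕ.+ D ℕ.* k         <⟨ ℕP.+-monoˡ-< (D ℕ.* k) (ℕP.≤-<-trans (ℕP.m≤n+m _ _) Cb<d) ⟩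
          d ℕ.+ D ℕ.* k                                ≡⟨ ℕP.+-comm d (D ℕ.* k) ⟩
          D ℕ.* k ℕ.+ d                                ≡⟨ cong (ℕ._+ d) e≡Dk ⟨
          e ℕ.+ d                                      ≡⟨ excess+deficit≡ c ⟩
          D ℕ.* ε (scale r h)                          ≡⟨ cong (D ℕ.*_) (dotℕ-scale r h δ) ⟩
          D ℕ.* (r ℕ.* ε h)                            ≡⟨ cong (λ z → D ℕ.* (r ℕ.* z)) ε≡ ⟩
          D ℕ.* (r ℕ.* (κ ℕ.+ κ′ ℕ.+ σ))               ≡⟨ cong (D ℕ.*_) (ℕP.*-distribˡ-+ r (κ ℕ.+ κ′) σ) ⟩
          D ℕ.* (r ℕ.* (κ ℕ.+ κ′) ℕ.+ r ℕ.* σ)         ≡⟨ ℕP.*-distribˡ-+ D (r ℕ.* (κ ℕ.+ κ′)) (r ℕ.* σ) ⟩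
          D ℕ.* (r ℕ.* (κ ℕ.+ κ′)) ℕ.+ D ℕ.* (r ℕ.* σ) ∎))
          where open ℕP.≤-Reasoning

        window : ∃[ j ] ∃[ jj ] j < r × jj < σ × k ∸ κ ≡ j ℕ.* σ ℕ.+ jj
        window = divide-window (ℕP.≤-<-trans (ℕP.m∸n≤m k κ) k<rσ)

        j jj : ℕ
        j  = proj₁ window
        jj = proj₁ (proj₂ window)

        j<r : j < r
        j<r = proj₁ (proj₂ (proj₂ window))

        jj<σ : jj < σ
        jj<σ = proj₁ (proj₂ (proj₂ (proj₂ window)))

        k∸κ≡ : k ∸ κ ≡ j ℕ.* σ ℕ.+ jj
        k∸κ≡ = proj₂ (proj₂ (proj₂ (proj₂ window)))

        jj-fits : κ ℕ.+ jj ℕ.+ κ′ ≤ ε h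
        jj-fits = begin
          κ ℕ.+ jj ℕ.+ κ′       ≡⟨ ℕ-+.xy∙z≈xz∙y κ jj κ′ ⟩
          κ ℕ.+ κ′ ℕ.+ jj       ≤⟨ ℕP.+-monoʳ-≤ (κ ℕ.+ κ′) (ℕP.<⇒≤ jj<σ) ⟩
          κ ℕ.+ κ′ ℕ.+ σ        ≡⟨ ε≡ ⟨
          ε h                   ∎
          where open ℕP.≤-Reasoning

        s : ℤ
        s = dot h ms ℤ.+ + (D ℕ.* (κ ℕ.+ jj))

        Dk≡ : D ℕ.* k ≡ D ℕ.* (j ℕ.* σ) ℕ.+ D ℕ.* (κ ℕ.+ jj)
        Dk≡ = begin
          D ℕ.* k                              ≡⟨ cong (D ℕ.*_) (ℕP.m+[n∸m]≡n (ℕP.<⇒≤ κ<k)) ⟨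
          D ℕ.* (κ ℕ.+ (k ∸ κ))                ≡⟨ cong (λ u → D ℕ.* (κ ℕ.+ u)) k∸κ≡ ⟩
          D ℕ.* (κ ℕ.+ (j ℕ.* σ ℕ.+ jj))       ≡⟨ cong (D ℕ.*_) (ℕ-+.x∙yz≈y∙xz κ (j ℕ.* σ) jj) ⟩
          D ℕ.* (j ℕ.* σ ℕ.+ (κ ℕ.+ jj))       ≡⟨ ℕP.*-distribˡ-+ D (j ℕ.* σ) (κ ℕ.+ jj) ⟩
          D ℕ.* (j ℕ.* σ) ℕ.+ D ℕ.* (κ ℕ.+ jj) ∎
          where open ≡-Reasoning

        n≡ : n ≡ xmid j ℤ.+ s
        n≡ = begin
          n                                                                     ≡⟨ sum≡ ⟨
          totalSum T                                                            ≡⟨ totalSum≡dot+excess imin c ⟩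
          dot (scale r h) ms ℤ.+ + e                                            ≡⟨ cong₂ (λ h′ e′ → dot h′ ms ℤ.+ + e′) (scale-suc r′ h) (trans e≡Dk Dk≡) ⟩
          dot (h +ᵛ ks) ms ℤ.+ (+ (D ℕ.* (j ℕ.* σ)) ℤ.+ + (D ℕ.* (κ ℕ.+ jj)))   ≡⟨ cong (ℤ._+ (+ (D ℕ.* (j ℕ.* σ)) ℤ.+ + (D ℕ.* (κ ℕ.+ jj)))) (dot-+ᵛ h ks ms) ⟩
          (dot h ms ℤ.+ xlow) ℤ.+ (+ (D ℕ.* (j ℕ.* σ)) ℤ.+ + (D ℕ.* (κ ℕ.+ jj))) ≡⟨ regroup (dot h ms) xlow _ _ ⟩
          xmid j ℤ.+ s                                                          ∎
          where
          open ≡-Reasoning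
          regroup : ∀ a b c d → (a ℤ.+ b) ℤ.+ (c ℤ.+ d) ≡ (b ℤ.+ c) ℤ.+ (a ℤ.+ d)
          regroup = ℤ-Solver.solve-∀

        covered : Covered n
        covered = xmid j , s , there (there (∈-map⁺ xmid (∈-upTo⁺ j<r))) , Reps⇒InRestricted (saturated h₀≤h jj jj-fits) , n≡

      covered : ∀ n → InRestricted t A (scale r h) n → Covered n
      covered n inR = by-size (excessᵀ ms T₀ ≤? Cb) (deficitᵀ Ms T₀ ≤? Cb)
        where
        R = InRestricted⇒Reps uA inR
        some-rep = Reps⇒IsRep 1≤t R
        T₀ = proj₁ some-rep
        T₀-rep = proj₂ some-rep
        by-size : Dec (excessᵀ ms T₀ ≤ Cb) → Dec (deficitᵀ Ms T₀ ≤ Cb) → Covered n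
        by-size (yes e≤Cb) _          = low-end T₀-rep e≤Cb R
        by-size (no e≰Cb)  (yes d≤Cb) = high-end T₀-rep d≤Cb R
        by-size (no e≰Cb)  (no d≰Cb)  = Middle.covered T₀-rep (ℕP.≰⇒> e≰Cb) (ℕP.≰⇒> d≰Cb)

    cover : Cover t
    cover = Vec.replicate q Cb , λ h Cb≤h → let open Profile h Cb≤h in X , length-X , covered

  cover-all : ∀ t → 1 ≤ t → Cover t
  cover-all (suc zero)    _ = cover (s≤s z≤n) singleton-family (bezout gap uses)
  cover-all (suc (suc t)) _ with distinct-nonmins?
  ... | inj₁ (γ₁ , γ₂ , γ₁✓ , γ₂✓ , γ₁≢γ₂ , γ₁-nonmin , γ₂-nonmin) =
        cover (s≤s z≤n) (pair-family (suc (suc t)) γ₁✓ γ₂✓ γ₁≢γ₂ γ₁-nonmin γ₂-nonmin) (bezout gap uses)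
  ... | inj₂ one = cover-rigid (s≤s (s≤s z≤n)) one

corollary2p19 : (q : ℕ) (A : Vec (List ℤ) q) →
  VAll.All (λ Ai → Unique Ai × Σ ℤ (λ a → a ∈ Ai)) A →
  (t r : ℕ) → 1 ≤ t → 1 ≤ r →
  Σ (Vec ℕ q) λ hrt → (h : Vec ℕ q) → Pointwise _≤_ hrt h →
    Σ (List ℤ) λ X → (length X ≤ r + 2) ×
      ((n : ℤ) → InRestricted t A (scale r h) n →
        ∃[ x ] ∃[ s ] (x ∈ X × InRestricted t A h s × n ≡ x ℤ.+ s))
corollary2p19 q A hyp t (suc r′) 1≤t (s≤s z≤n) = Covering.cover-all A distinct imin imax r′ t 1≤t
  where
  distinct = VAll.map proj₁ hyp
  imin     = proj₂ (choose-pointwise (VAll.map (nonempty⇒min ∘ proj₂) hyp))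
  imax     = proj₂ (choose-pointwise (VAll.map (nonempty⇒max ∘ proj₂) hyp))
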